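{- There exist a predicate $P\colon\mathbb{Z}_6\to\{0,1\}$, an integer $k=2^{O(\sqrt{n\log n})}$, functions $A,B\colon\{0,1\}^n\to\mathbb{Z}_6^k$, and a polynomial $C$ over $\mathbb{Z}_6$ of degree $2$ in $2k$ variables such that for all $x,y\in\{0,1\}^n$, $P(C(A(x),B(y)))=\mathrm{EQ}(x,y)$, where $\mathrm{EQ}(x,y)=1$ iff $x=y$.
   Context: $\mathbb{Z}_6$ denotes the ring of integers modulo $6$. This is a BSM protocol for equality on $2n$ input bits in which Alice and Bob output vectors in $\mathbb{Z}_6^k$ and Carol computes a degree-2 polynomial over $\mathbb{Z}_6$ followed by the predicate $P$. -}

module Defs where

open import Data.Nat using (ℕ; zero; suc; _+_; _*_; _^_; _≤_)
open import Data.Nat.DivMod using (_mod_)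
open import Data.Nat.Logarithm using (⌈log₂_⌉)
open import Data.Fin using (Fin; toℕ)
open import Data.Bool using (Bool)
open import Data.Bool.Properties using () renaming (_≟_ to _≟B_)
open import Data.Vec using (Vec)
open import Data.Vec.Properties using (≡-dec)
open import Data.Vec.Functional using (Vector; _++_)
open import Data.Product using (∃-syntax; _×_)
open import Relation.Nullary.Decidable using (⌊_⌋)

ℤ₆ : Set
ℤ₆ = Fin 6

infixl 6 _+₆_
infixl 7 _*₆_

_+₆_ : ℤ₆ → ℤ₆ → ℤ₆
a +₆ b = (toℕ a + toℕ b) mod 6

_*₆_ : ℤ₆ → ℤ₆ → ℤ₆
a *₆ b = (toℕ a * toℕ b) mod 6

0₆ : ℤ₆
0₆ = 0 mod 6

Σ₆ : (m : ℕ) → (Fin m → ℤ₆) → ℤ₆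
Σ₆ zero    f = 0₆
Σ₆ (suc m) f = f Data.Fin.zero +₆ Σ₆ m (λ i → f (Data.Fin.suc i))

-- A polynomial over Z_6 of degree at most 2 in m variables z_0 … z_{m-1}:
--   c₀ + Σ_i lin i · z_i + Σ_{i,j} quad i j · z_i · z_j .
-- Every polynomial of degree ≤ 2 has such a representation and vice versa.
record Poly₂ (m : ℕ) : Set where
  constructor poly₂
  field
    const : ℤ₆
    lin   : Fin m → ℤ₆
    quad  : Fin m → Fin m → ℤ₆

eval₂ : {m : ℕ} → Poly₂ m → Vector ℤ₆ m → ℤ₆
eval₂ {m} (poly₂ c l q) z =
  c +₆ Σ₆ m (λ i → l i *₆ z i) +₆ Σ₆ m (λ i → Σ₆ m (λ j → q i j *₆ z i *₆ z j))

EQ : {n : ℕ} → Vec Bool n → Vec Bool n → Bool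
EQ x y = ⌊ ≡-dec _≟B_ x y ⌋

-- k = 2^{O(√(n log n))}, witnessed by constant c: k ≤ 2^e for some e with
-- e ≤ √(c · n · ⌈log₂ n⌉), i.e. e² ≤ c · n · ⌈log₂ n⌉.
BoundedBy : ℕ → ℕ → ℕ → Set
BoundedBy c n k = ∃[ e ] (k ≤ 2 ^ e × e * e ≤ c * n * ⌈log₂ n ⌉)

-- Cut the n coordinates into m ≤ n blocks of ⌈log₂ n⌉ coordinates. On a block c the indicator
-- that x and y agree is a product of |c| indicators [x_l = y_l], hence a sum of 2^|c| ≤ 2n
-- products f(x)·g(y); so is z_c = 1 - [x and y agree on c], and w = Σ_c z_c counts the blocks
-- on which x and y differ. Since every z_c is 0 or 1, the elementary symmetric polynomial
-- e_r(z) equals the binomial coefficient C(w, r), and by Lucas' theorem e_{p^j}(z) is congruent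
-- modulo p to the j-th base-p digit of w. The Barrington–Beigel–Rudich polynomial
-- Q = 3·(1 + Π_{j<a} (1 + e_{2^j})) + 4·(1 + 2·Π_{j<b} (1 + 2·e_{3^j}²)) is congruent to its
-- first bracket modulo 2 and to its second modulo 3, so Q ≡ 0 (mod 6) exactly when the lowest
-- a binary and b ternary digits of w vanish; with 2^a·3^b > m ≥ w this means w = 0, i.e. x = y.
-- Choosing 2^a ≈ 3^b ≈ √m, expanding Q in the z_c gives k = n^{O(√m)} = 2^{O(√(n log n))}
-- products f_i(x)·g_i(y). Alice sends (f_i(x) mod 6)_i, Bob (g_i(y) mod 6)_i, and Carol
-- evaluates the inner product and tests it for zero.

module Submission where

open import Defs
open import Level using (0ℓ)
open import Function using (case_of_)
open import Data.Empty using (⊥; ⊥-elim)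
open import Data.Sum using (_⊎_; inj₁; inj₂)
open import Data.Product using (Σ-syntax; ∃-syntax; _×_; _,_; proj₁; proj₂)
open import Data.Bool using (Bool; true; false)
open import Data.Bool.Properties using () renaming (_≟_ to _≟ᴮ_)
open import Data.Nat
  using (ℕ; zero; suc; pred; _+_; _*_; _^_; _∸_; _≤_; _<_; _≡ᵇ_; ⌊_/2⌋; ⌈_/2⌉; NonZero;
         s≤s; z≤n; z<s; s<s)
open import Data.Nat.Properties
open import Data.Nat.DivMod
  using (_%_; _/_; _mod_; m%n%n≡m%n; m<n⇒m%n≡m; %-distribˡ-+; %-distribˡ-*; [m+kn]%n≡m%n;
         m∣n⇒o%n%m≡o%m; m≡m%n+[m/n]*n; m%n<n; n/1≡n; m/n/o≡m/[n*o])
open import Data.Nat.Divisibility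
  using (_∣_; divides; 1∣_; ∣⇒≤; m%n≡0⇒n∣m; m∣n/o⇒o*m∣n; *-monoʳ-∣; *-cancelˡ-∣; m*n∣⇒m∣)
open import Data.Nat.Primality using (Prime; prime?; euclidsLemma; prime⇒nonZero)
open import Data.Nat.Combinatorics
  using (nC1≡n; k>n⇒nCk≡0; nCk+nC[k+1]≡[n+1]C[k+1]) renaming (_C_ to _choose_)
open import Data.Nat.Logarithm using (⌈log₂_⌉; ⌈log₂⌉-mono-≤; ⌈log₂2^n⌉≡n)
open import Data.Nat.Logarithm.Core using (⌈log2⌉)
open import Data.Nat.Induction using (<-wellFounded)
open import Data.Nat.ListAction using (sum)
open import Data.Nat.Tactic.RingSolver using (solve-∀)
open import Data.Fin as Fin using (Fin; toℕ; splitAt; _↑ˡ_; _↑ʳ_)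
open import Data.Fin.Properties using (toℕ<n; toℕ-fromℕ<; splitAt-↑ˡ; splitAt-↑ʳ)
open import Data.List as List using (List; []; _∷_; map; length; take; drop; allFin)
open import Data.List.Properties
  using (length-++; length-map; map-∘; length-tabulate; length-take; length-drop; take++drop≡id)
open import Data.List.Membership.Propositional using (_∈_)
open import Data.List.Membership.Propositional.Properties using (∈-++⁻; ∈-map⁺; ∈-allFin)
open import Data.List.Relation.Unary.Any using (here; there)
open import Data.List.Relation.Unary.All as All using (All; []; _∷_)
open import Data.List.Relation.Unary.All.Properties using (map⁺)
open import Data.Vec using (Vec)
import Data.Vec as Vec
open import Data.Vec.Properties using (≡-dec)
open import Data.Vec.Functional using (Vector; _++_)
open import Induction.WellFounded using (Acc; acc)
open import Relation.Nullary using (¬_; Dec; yes; no)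
open import Relation.Nullary.Decidable using (⌊_⌋; from-yes)
open import Relation.Binary.Bundles using (Setoid)
open import Relation.Binary.PropositionalEquality
  using (_≡_; _≢_; refl; sym; trans; cong; cong₂; subst; module ≡-Reasoning)

private variable
  a b c d j k m n q u v w : ℕ

infix 4 _≡_modulo_
record _≡_modulo_ (a b m : ℕ) .{{_ : NonZero m}} : Set where
  constructor mod-≡
  field ≡-%-mod : a % m ≡ b % m
open _≡_modulo_ public

module _ {m : ℕ} .{{_ : NonZero m}} where

  ≡-mod-refl : a ≡ a modulo m
  ≡-mod-refl = mod-≡ refl

  ≡-mod-sym : a ≡ b modulo m → b ≡ a modulo m
  ≡-mod-sym (mod-≡ eq) = mod-≡ (sym eq)

  ≡-mod-trans : a ≡ b modulo m → b ≡ c modulo m → a ≡ c modulo m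
  ≡-mod-trans (mod-≡ eq) (mod-≡ eq′) = mod-≡ (trans eq eq′)

  ≡⇒≡-mod : a ≡ b → a ≡ b modulo m
  ≡⇒≡-mod refl = ≡-mod-refl

  +-cong-mod : a ≡ b modulo m → c ≡ d modulo m → a + c ≡ b + d modulo m
  +-cong-mod {a} {b} {c} {d} (mod-≡ eq) (mod-≡ eq′) = mod-≡ (begin
    (a + c) % m           ≡⟨ %-distribˡ-+ a c m ⟩
    (a % m + c % m) % m   ≡⟨ cong₂ (λ s t → (s + t) % m) eq eq′ ⟩
    (b % m + d % m) % m   ≡⟨ %-distribˡ-+ b d m ⟨
    (b + d) % m           ∎)
    where open ≡-Reasoning

  *-cong-mod : a ≡ b modulo m → c ≡ d modulo m → a * c ≡ b * d modulo m
  *-cong-mod {a} {b} {c} {d} (mod-≡ eq) (mod-≡ eq′) = mod-≡ (begin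
    (a * c) % m           ≡⟨ %-distribˡ-* a c m ⟩
    (a % m * (c % m)) % m ≡⟨ cong₂ (λ s t → (s * t) % m) eq eq′ ⟩
    (b % m * (d % m)) % m ≡⟨ %-distribˡ-* b d m ⟨
    (b * d) % m           ∎)
    where open ≡-Reasoning

  +-congˡ-mod : ∀ a → b ≡ c modulo m → a + b ≡ a + c modulo m
  +-congˡ-mod a = +-cong-mod (≡-mod-refl {a = a})

  *-congˡ-mod : ∀ a → b ≡ c modulo m → a * b ≡ a * c modulo m
  *-congˡ-mod a = *-cong-mod (≡-mod-refl {a = a})

  +-*-mod : ∀ a k → a + k * m ≡ a modulo m
  +-*-mod a k = mod-≡ ([m+kn]%n≡m%n a k m)

≡-mod-setoid : (m : ℕ) .{{_ : NonZero m}} → Setoid 0ℓ 0ℓ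
≡-mod-setoid m = record
  { Carrier       = ℕ
  ; _≈_           = λ a b → a ≡ b modulo m
  ; isEquivalence = record { refl = ≡-mod-refl ; sym = ≡-mod-sym ; trans = ≡-mod-trans }
  }

module ≡-mod-Reasoning (m : ℕ) .{{_ : NonZero m}} where
  open import Relation.Binary.Reasoning.Setoid (≡-mod-setoid m) public

≡-mod-∣ : .{{_ : NonZero m}} .{{_ : NonZero n}} → m ∣ n → a ≡ b modulo n → a ≡ b modulo m
≡-mod-∣ {m} {n} {a} {b} m∣n (mod-≡ eq) =
  mod-≡ (trans (sym (m∣n⇒o%n%m≡o%m m n a m∣n)) (trans (cong (_% m) eq) (m∣n⇒o%n%m≡o%m m n b m∣n)))

≡0-mod⇒∣ : .{{_ : NonZero m}} → a ≡ 0 modulo m → m ∣ a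
≡0-mod⇒∣ {m = suc _} {a} (mod-≡ a%m≡0) = m%n≡0⇒n∣m a _ a%m≡0

mod-2-cases : ∀ n → n ≡ 0 modulo 2 ⊎ n ≡ 1 modulo 2
mod-2-cases n with n % 2 in eq | m%n<n n 2
... | 0 | _                 = inj₁ (mod-≡ eq)
... | 1 | _                 = inj₂ (mod-≡ eq)
... | suc (suc _) | s≤s (s≤s ())

mod-3-cases : ∀ n → n ≡ 0 modulo 3 ⊎ (n ≡ 1 modulo 3 ⊎ n ≡ 2 modulo 3)
mod-3-cases n with n % 3 in eq | m%n<n n 3
... | 0 | _                 = inj₁ (mod-≡ eq)
... | 1 | _                 = inj₂ (inj₁ (mod-≡ eq))
... | 2 | _                 = inj₂ (inj₂ (mod-≡ eq))
... | suc (suc (suc _)) | s≤s (s≤s (s≤s ()))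

1≢0-mod : ¬ 1 ≡ 0 modulo (2 + m)
1≢0-mod (mod-≡ ())

∏< : ℕ → (ℕ → ℕ) → ℕ
∏< zero    f = 1
∏< (suc a) f = ∏< a f * f a

∏<-cong : ∀ a {f g : ℕ → ℕ} → (∀ j → f j ≡ g j) → ∏< a f ≡ ∏< a g
∏<-cong zero    f≡g = refl
∏<-cong (suc a) f≡g = cong₂ _*_ (∏<-cong a f≡g) (f≡g a)

module _ {m : ℕ} .{{_ : NonZero m}} where

  ∏<-≡-0-mod : ∀ a f → j < a → f j ≡ 0 modulo m → ∏< a f ≡ 0 modulo m
  ∏<-≡-0-mod (suc a) f j<1+a fj≡0 with m≤n⇒m<n∨m≡n (≤-pred j<1+a)
  ... | inj₁ j<a  = *-cong-mod (∏<-≡-0-mod a f j<a fj≡0) (≡-mod-refl {a = f a})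
  ... | inj₂ refl = ≡-mod-trans (*-congˡ-mod (∏< a f) fj≡0) (≡⇒≡-mod (*-zeroʳ (∏< a f)))

  ∏<-≡-1-mod : ∀ a f → (∀ j → j < a → f j ≡ 1 modulo m) → ∏< a f ≡ 1 modulo m
  ∏<-≡-1-mod zero    f fj≡1 = ≡-mod-refl
  ∏<-≡-1-mod (suc a) f fj≡1 =
    *-cong-mod (∏<-≡-1-mod a f (λ j j<a → fj≡1 j (m<n⇒m<1+n j<a))) (fj≡1 a ≤-refl)

∏<-bound : ∀ {T} .{{_ : NonZero T}} q a (g : ℕ → ℕ) → (∀ j → g j ≤ 1 + T ^ (q * suc q ^ j)) →
           ∏< a g ≤ 2 ^ a * T ^ (suc q ^ a)
∏<-bound {T} q zero    g g≤ = subst (1 ≤_) (sym (*-identityˡ (T ^ 1))) (m^n>0 T 1)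
∏<-bound {T} q (suc a) g g≤ = begin
  ∏< a g * g a                                 ≤⟨ *-mono-≤ (∏<-bound q a g g≤) (g≤ a) ⟩
  2 ^ a * T ^ P * (1 + T ^ (q * P))
    ≤⟨ *-monoʳ-≤ (2 ^ a * T ^ P) (+-monoˡ-≤ (T ^ (q * P)) (m^n>0 T (q * P))) ⟩
  2 ^ a * T ^ P * (T ^ (q * P) + T ^ (q * P))  ≡⟨ regroup (2 ^ a) (T ^ P) (T ^ (q * P)) ⟩
  2 * 2 ^ a * (T ^ P * T ^ (q * P))            ≡⟨ cong (2 * 2 ^ a *_) (^-distribˡ-+-* T P (q * P)) ⟨
  2 * 2 ^ a * T ^ (P + q * P)                  ∎
  where
  open ≤-Reasoning
  P = suc q ^ a
  regroup : ∀ s t u → s * t * (u + u) ≡ 2 * s * (t * u)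
  regroup = solve-∀

sum-bits≤length : ∀ {vs} → All (_≤ 1) vs → sum vs ≤ length vs
sum-bits≤length []           = z≤n
sum-bits≤length (v≤1 ∷ bits) = +-mono-≤ v≤1 (sum-bits≤length bits)

sum-zeros : ∀ {vs} → All (_≡ 0) vs → sum vs ≡ 0
sum-zeros []              = refl
sum-zeros (refl ∷ zeros) = sum-zeros zeros

∈⇒≤sum : ∀ {vs} → v ∈ vs → v ≤ sum vs
∈⇒≤sum {vs = v ∷ vs} (here refl) = m≤m+n v (sum vs)
∈⇒≤sum {vs = u ∷ vs} (there v∈vs) = ≤-trans (∈⇒≤sum v∈vs) (m≤n+m (sum vs) u)

sum-map-≤ : ∀ {A : Set} {f : A → ℕ} {xs} → All (λ x → f x ≤ m) xs → sum (map f xs) ≤ length xs * m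
sum-map-≤ []            = z≤n
sum-map-≤ (fx≤m ∷ f≤m) = +-mono-≤ fx≤m (sum-map-≤ f≤m)

module _ {p : ℕ} (p-prime : Prime p) (p∤m : ¬ p ∣ m) where

  prime∣^*⇒∣ : ∀ a → p ∣ m ^ a * q → p ∣ q
  prime∣^*⇒∣ {q} zero    p∣q = subst (p ∣_) (+-identityʳ q) p∣q
  prime∣^*⇒∣ {q} (suc a) p∣m*m^a*q
    with euclidsLemma m (m ^ a * q) p-prime (subst (p ∣_) (*-assoc m (m ^ a) q) p∣m*m^a*q)
  ... | inj₁ p∣m     = ⊥-elim (p∤m p∣m)
  ... | inj₂ p∣m^a*q = prime∣^*⇒∣ a p∣m^a*q

  prime^∣^*⇒∣ : ∀ b a → p ^ b ∣ m ^ a * q → p ^ b ∣ q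
  prime^∣^*⇒∣ {q} zero    a _ = 1∣ q
  prime^∣^*⇒∣ {q} (suc b) a p^1+b∣m^a*q with prime∣^*⇒∣ a (m*n∣⇒m∣ p (p ^ b) p^1+b∣m^a*q)
  ... | divides q′ refl =
    subst (p * p ^ b ∣_) (*-comm p q′) (*-monoʳ-∣ p (prime^∣^*⇒∣ b a p^b∣m^a*q′))
    where
    instance _ = prime⇒nonZero p-prime
    shuffle : ∀ x y z → x * (y * z) ≡ z * (x * y)
    shuffle = solve-∀
    p^b∣m^a*q′ : p ^ b ∣ m ^ a * q′
    p^b∣m^a*q′ = *-cancelˡ-∣ p (subst (p * p ^ b ∣_) (shuffle (m ^ a) q′ p) p^1+b∣m^a*q)

3∤2 : ¬ 3 ∣ 2
3∤2 3∣2 with ∣⇒≤ 3∣2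
... | s≤s (s≤s ())

2^a∣w∧3^b∣w∧w<2^a*3^b⇒w≡0 : 2 ^ a ∣ w → 3 ^ b ∣ w → w < 2 ^ a * 3 ^ b → w ≡ 0
2^a∣w∧3^b∣w∧w<2^a*3^b⇒w≡0 {w = zero} _ _ _ = refl
2^a∣w∧3^b∣w∧w<2^a*3^b⇒w≡0 {w = suc _} (divides zero ()) _ _
2^a∣w∧3^b∣w∧w<2^a*3^b⇒w≡0 {a} {w} {b} (divides q@(suc _) w≡q*2^a) 3^b∣w w< =
  ⊥-elim (<⇒≱ w< (begin
    2 ^ a * 3 ^ b ≤⟨ *-monoʳ-≤ (2 ^ a) (∣⇒≤ 3^b∣q) ⟩
    2 ^ a * q     ≡⟨ *-comm (2 ^ a) q ⟩
    q * 2 ^ a     ≡⟨ w≡q*2^a ⟨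
    w             ∎))
  where
  open ≤-Reasoning
  3^b∣q : 3 ^ b ∣ q
  3^b∣q = prime^∣^*⇒∣ (from-yes (prime? 3)) 3∤2 b a
    (subst (3 ^ b ∣_) (trans w≡q*2^a (*-comm q (2 ^ a))) 3^b∣w)

pascal : ∀ n k → suc n choose suc k ≡ n choose k + n choose suc k
pascal n k = sym (nCk+nC[k+1]≡[n+1]C[k+1] n k)

-- The hypothesis is (1 + X)^p ≡ 1 + X^p (mod p) read coefficientwise; for p = 2, 3 it is checked
-- directly below.
module Lucas (p : ℕ) .{{_ : NonZero p}}
  (frobenius : ∀ x y → (p + x) choose (p + y) ≡ x choose y + x choose (p + y) modulo p) where

  infixl 7 _/p^_
  _/p^_ : ℕ → ℕ → ℕ
  w /p^ j = (w / p ^ j) {{m^n≢0 p j}}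

  w/p/p^j≡w/p^[1+j] : ∀ w j → w / p /p^ j ≡ w /p^ suc j
  w/p/p^j≡w/p^[1+j] w j = m/n/o≡m/[n*o] w p (p ^ j) {{_}} {{m^n≢0 p j}} {{m^n≢0 p (suc j)}}

  [p*w+u]C[p*r]≡wCr : ∀ w r → u < p → (p * w + u) choose (p * r) ≡ w choose r modulo p
  [p*w+u]C[p*r]≡wCr zero    zero    u<p rewrite *-zeroʳ p = ≡-mod-refl
  [p*w+u]C[p*r]≡wCr {u} zero (suc r) u<p rewrite *-zeroʳ p =
    ≡⇒≡-mod (k>n⇒nCk≡0 (<-≤-trans u<p (m≤m*n p (suc r))))
  [p*w+u]C[p*r]≡wCr (suc w) zero    u<p rewrite *-zeroʳ p = ≡-mod-refl
  [p*w+u]C[p*r]≡wCr {u} (suc w) (suc r) u<p = begin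
    (p * suc w + u) choose (p * suc r)       ≡⟨ cong₂ _choose_ p*[1+w]+u≡p+X (*-suc p r) ⟩
    (p + X) choose (p + p * r)               ≈⟨ frobenius X (p * r) ⟩
    X choose (p * r) + X choose (p + p * r)  ≈⟨ +-cong-mod ([p*w+u]C[p*r]≡wCr w r u<p) XC[p+p*r]≡wC[1+r] ⟩
    w choose r + w choose suc r              ≡⟨ pascal w r ⟨
    suc w choose suc r                       ∎
    where
    open ≡-mod-Reasoning p
    X = p * w + u
    p*[1+w]+u≡p+X : p * suc w + u ≡ p + X
    p*[1+w]+u≡p+X = trans (cong (_+ u) (*-suc p w)) (+-assoc p (p * w) u)
    XC[p+p*r]≡wC[1+r] : X choose (p + p * r) ≡ w choose suc r modulo p
    XC[p+p*r]≡wC[1+r] = subst (λ h → X choose h ≡ w choose suc r modulo p) (*-suc p r)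
                          ([p*w+u]C[p*r]≡wCr w (suc r) u<p)

  wC[p^j]≡w/p^j : ∀ j w → w choose (p ^ j) ≡ w /p^ j modulo p
  wC[p^j]≡w/p^j zero    w rewrite nC1≡n w | n/1≡n w = ≡-mod-refl
  wC[p^j]≡w/p^j (suc j) w = begin
    w choose (p * p ^ j)                      ≡⟨ cong (_choose (p * p ^ j)) w≡p*[w/p]+w%p ⟩
    (p * (w / p) + w % p) choose (p * p ^ j)  ≈⟨ [p*w+u]C[p*r]≡wCr (w / p) (p ^ j) (m%n<n w p) ⟩
    (w / p) choose (p ^ j)                    ≈⟨ wC[p^j]≡w/p^j j (w / p) ⟩
    w / p /p^ j                               ≡⟨ w/p/p^j≡w/p^[1+j] w j ⟩
    w /p^ suc j                               ∎
    where
    open ≡-mod-Reasoning p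
    w≡p*[w/p]+w%p : w ≡ p * (w / p) + w % p
    w≡p*[w/p]+w%p = trans (m≡m%n+[m/n]*n w p)
                      (trans (+-comm (w % p) _) (cong (_+ w % p) (*-comm (w / p) p)))

  w/p^j≡0⇒p^a∣w : ∀ a w → (∀ j → j < a → w /p^ j ≡ 0 modulo p) → p ^ a ∣ w
  w/p^j≡0⇒p^a∣w zero    w _ = 1∣ w
  w/p^j≡0⇒p^a∣w (suc a) w digits≡0 = m∣n/o⇒o*m∣n p∣w (w/p^j≡0⇒p^a∣w a (w / p) digits/p≡0)
    where
    p∣w : p ∣ w
    p∣w = ≡0-mod⇒∣ (subst (λ s → s ≡ 0 modulo p) (n/1≡n w) (digits≡0 0 z<s))
    digits/p≡0 : ∀ j → j < a → w / p /p^ j ≡ 0 modulo p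
    digits/p≡0 j j<a = subst (λ s → s ≡ 0 modulo p) (sym (w/p/p^j≡w/p^[1+j] w j))
                         (digits≡0 (suc j) (s<s j<a))

  wC[p^j]≡0⇒p^a∣w : ∀ a w → (∀ j → j < a → w choose (p ^ j) ≡ 0 modulo p) → p ^ a ∣ w
  wC[p^j]≡0⇒p^a∣w a w C≡0 =
    w/p^j≡0⇒p^a∣w a w (λ j j<a → ≡-mod-trans (≡-mod-sym (wC[p^j]≡w/p^j j w)) (C≡0 j j<a))

[2+x]C[2+y]≡ : ∀ x y →
  (2 + x) choose (2 + y) ≡ x choose y + x choose (2 + y) + (x choose (1 + y)) * 2
[2+x]C[2+y]≡ x y = begin
  (2 + x) choose (2 + y)
    ≡⟨ pascal (1 + x) (1 + y) ⟩
  (1 + x) choose (1 + y) + (1 + x) choose (2 + y)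
    ≡⟨ cong₂ _+_ (pascal x y) (pascal x (1 + y)) ⟩
  (x choose y + x choose (1 + y)) + (x choose (1 + y) + x choose (2 + y))
    ≡⟨ rearrange (x choose y) (x choose (1 + y)) (x choose (2 + y)) ⟩
  x choose y + x choose (2 + y) + (x choose (1 + y)) * 2 ∎
  where
  open ≡-Reasoning
  rearrange : ∀ s t u → (s + t) + (t + u) ≡ s + u + t * 2
  rearrange = solve-∀

[3+x]C[3+y]≡ : ∀ x y →
  (3 + x) choose (3 + y) ≡ x choose y + x choose (3 + y) + (x choose (1 + y) + x choose (2 + y)) * 3
[3+x]C[3+y]≡ x y = begin
  (3 + x) choose (3 + y)
    ≡⟨ [2+x]C[2+y]≡ (1 + x) (1 + y) ⟩
  (1 + x) choose (1 + y) + (1 + x) choose (3 + y) + ((1 + x) choose (2 + y)) * 2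
    ≡⟨ cong₂ _+_ (cong₂ _+_ (pascal x y) (pascal x (2 + y))) (cong (_* 2) (pascal x (1 + y))) ⟩
  (x choose y + x choose (1 + y)) + (x choose (2 + y) + x choose (3 + y))
    + (x choose (1 + y) + x choose (2 + y)) * 2
    ≡⟨ rearrange (x choose y) (x choose (1 + y)) (x choose (2 + y)) (x choose (3 + y)) ⟩
  x choose y + x choose (3 + y) + (x choose (1 + y) + x choose (2 + y)) * 3 ∎
  where
  open ≡-Reasoning
  rearrange : ∀ s t u v → (s + t) + (u + v) + (t + u) * 2 ≡ s + v + (t + u) * 3
  rearrange = solve-∀

frobenius₂ : ∀ x y → (2 + x) choose (2 + y) ≡ x choose y + x choose (2 + y) modulo 2
frobenius₂ x y = ≡-mod-trans (≡⇒≡-mod ([2+x]C[2+y]≡ x y)) (+-*-mod _ (x choose (1 + y)))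

frobenius₃ : ∀ x y → (3 + x) choose (3 + y) ≡ x choose y + x choose (3 + y) modulo 3
frobenius₃ x y = ≡-mod-trans (≡⇒≡-mod ([3+x]C[3+y]≡ x y)) (+-*-mod _ (x choose (1 + y) + x choose (2 + y)))

module Lucas₂ = Lucas 2 frobenius₂
module Lucas₃ = Lucas 3 frobenius₃

esym : ℕ → List ℕ → ℕ
esym zero    _        = 1
esym (suc r) []       = 0
esym (suc r) (v ∷ vs) = esym (suc r) vs + v * esym r vs

esym-cong-mod : .{{_ : NonZero m}} {A : Set} {f g : A → ℕ} → (∀ x → f x ≡ g x modulo m) →
                ∀ r xs → esym r (map f xs) ≡ esym r (map g xs) modulo m
esym-cong-mod f≡g zero    xs       = ≡-mod-refl
esym-cong-mod f≡g (suc r) []       = ≡-mod-refl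
esym-cong-mod f≡g (suc r) (x ∷ xs) =
  +-cong-mod (esym-cong-mod f≡g (suc r) xs) (*-cong-mod (f≡g x) (esym-cong-mod f≡g r xs))

esym-bits≡sumCr : ∀ {vs} → All (_≤ 1) vs → ∀ r → esym r vs ≡ sum vs choose r
esym-bits≡sumCr _                                  zero    = refl
esym-bits≡sumCr []                                 (suc r) = refl
esym-bits≡sumCr {0 ∷ vs}           (_ ∷ bits)      (suc r) =
  trans (+-identityʳ _) (esym-bits≡sumCr bits (suc r))
esym-bits≡sumCr {1 ∷ vs}           (_ ∷ bits)      (suc r) = begin
  esym (suc r) vs + (esym r vs + 0)      ≡⟨ cong₂ _+_ (esym-bits≡sumCr bits (suc r))
                                                      (trans (+-identityʳ _) (esym-bits≡sumCr bits r)) ⟩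
  sum vs choose suc r + sum vs choose r  ≡⟨ +-comm (sum vs choose suc r) _ ⟩
  sum vs choose r + sum vs choose suc r  ≡⟨ pascal (sum vs) r ⟨
  suc (sum vs) choose suc r              ∎
  where open ≡-Reasoning
esym-bits≡sumCr {suc (suc _) ∷ vs} (s≤s () ∷ _)   (suc r)

-- Here e r stands for e_r(z) ≡ C(w, r), so e (p ^ j) is the j-th base-p digit of w modulo p.
Q₂ : (ℕ → ℕ) → ℕ → ℕ
Q₂ e a = 1 + ∏< a (λ j → 1 + e (2 ^ j))

-- 1 + 2d² ≡ 0 (mod 3) for every d ≢ 0 (mod 3).
Q₃ : (ℕ → ℕ) → ℕ → ℕ
Q₃ e b = 1 + 2 * ∏< b (λ j → 1 + 2 * (e (3 ^ j) * e (3 ^ j)))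

-- 3 and 4 are the idempotents of ℤ/6 ≅ ℤ/2 × ℤ/3.
Q₆ : (ℕ → ℕ) → ℕ → ℕ → ℕ
Q₆ e a b = 3 * Q₂ e a + 4 * Q₃ e b

Q₆≡Q₂-mod-2 : ∀ e a b → Q₆ e a b ≡ Q₂ e a modulo 2
Q₆≡Q₂-mod-2 e a b =
  ≡-mod-trans (≡⇒≡-mod (split (Q₂ e a) (Q₃ e b))) (+-*-mod (Q₂ e a) (Q₂ e a + 2 * Q₃ e b))
  where
  split : ∀ s t → 3 * s + 4 * t ≡ s + (s + 2 * t) * 2
  split = solve-∀

Q₆≡Q₃-mod-3 : ∀ e a b → Q₆ e a b ≡ Q₃ e b modulo 3
Q₆≡Q₃-mod-3 e a b =
  ≡-mod-trans (≡⇒≡-mod (split (Q₂ e a) (Q₃ e b))) (+-*-mod (Q₃ e b) (Q₂ e a + Q₃ e b))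
  where
  split : ∀ s t → 3 * s + 4 * t ≡ t + (s + t) * 3
  split = solve-∀

module _ {e : ℕ → ℕ} where

  e≡0Cr⇒Q₆≡0 : (∀ r → e r ≡ 0 choose r modulo 6) → ∀ a b → Q₆ e a b ≡ 0 modulo 6
  e≡0Cr⇒Q₆≡0 e≡0Cr a b =
    ≡-mod-trans (+-cong-mod (*-congˡ-mod 3 Q₂≡2) (*-congˡ-mod 4 Q₃≡3)) (mod-≡ refl)
    where
    e≡0 : ∀ r → 0 < r → e r ≡ 0 modulo 6
    e≡0 (suc r) _ = e≡0Cr (suc r)
    Q₂≡2 : Q₂ e a ≡ 2 modulo 6
    Q₂≡2 = +-congˡ-mod 1 (∏<-≡-1-mod a _ (λ j _ → +-congˡ-mod 1 (e≡0 (2 ^ j) (m^n>0 2 j))))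
    Q₃≡3 : Q₃ e b ≡ 3 modulo 6
    Q₃≡3 = +-congˡ-mod 1 (*-congˡ-mod 2 (∏<-≡-1-mod b _ (λ j _ →
             +-congˡ-mod 1 (*-congˡ-mod 2 (*-cong-mod (e≡0 (3 ^ j) (m^n>0 3 j)) (e≡0 (3 ^ j) (m^n>0 3 j)))))))

  Q₂≡0⇒2^a∣w : (∀ r → e r ≡ w choose r modulo 2) → ∀ a → Q₂ e a ≡ 0 modulo 2 → 2 ^ a ∣ w
  Q₂≡0⇒2^a∣w {w} e≡wCr a Q₂≡0 = Lucas₂.wC[p^j]≡0⇒p^a∣w a w wC2^j≡0
    where
    wC2^j≡0 : ∀ j → j < a → w choose 2 ^ j ≡ 0 modulo 2
    wC2^j≡0 j j<a with mod-2-cases (w choose 2 ^ j)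
    ... | inj₁ wC2^j≡0 = wC2^j≡0
    ... | inj₂ wC2^j≡1 = ⊥-elim (1≢0-mod (≡-mod-trans (≡-mod-sym Q₂≡1) Q₂≡0))
      where
      Q₂≡1 : Q₂ e a ≡ 1 modulo 2
      Q₂≡1 = +-congˡ-mod 1 (∏<-≡-0-mod a _ j<a
               (≡-mod-trans (+-congˡ-mod 1 (≡-mod-trans (e≡wCr (2 ^ j)) wC2^j≡1)) (mod-≡ refl)))

  Q₃≡0⇒3^b∣w : (∀ r → e r ≡ w choose r modulo 3) → ∀ b → Q₃ e b ≡ 0 modulo 3 → 3 ^ b ∣ w
  Q₃≡0⇒3^b∣w {w} e≡wCr b Q₃≡0 = Lucas₃.wC[p^j]≡0⇒p^a∣w b w wC3^j≡0
    where
    factor≡0 : ∀ j d → w choose 3 ^ j ≡ d modulo 3 → 1 + 2 * (d * d) ≡ 0 modulo 3 →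
               1 + 2 * (e (3 ^ j) * e (3 ^ j)) ≡ 0 modulo 3
    factor≡0 j d wC3^j≡d 1+2d²≡0 =
      ≡-mod-trans (+-congˡ-mod 1 (*-congˡ-mod 2 (*-cong-mod e≡d e≡d))) 1+2d²≡0
      where
      e≡d : e (3 ^ j) ≡ d modulo 3
      e≡d = ≡-mod-trans (e≡wCr (3 ^ j)) wC3^j≡d
    Q₃≢0 : ∀ j → j < b → 1 + 2 * (e (3 ^ j) * e (3 ^ j)) ≡ 0 modulo 3 → ⊥
    Q₃≢0 j j<b factor≡0 = 1≢0-mod (≡-mod-trans (≡-mod-sym Q₃≡1) Q₃≡0)
      where
      Q₃≡1 : Q₃ e b ≡ 1 modulo 3
      Q₃≡1 = +-congˡ-mod 1 (*-congˡ-mod 2 (∏<-≡-0-mod b _ j<b factor≡0))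
    wC3^j≡0 : ∀ j → j < b → w choose 3 ^ j ≡ 0 modulo 3
    wC3^j≡0 j j<b with mod-3-cases (w choose 3 ^ j)
    ... | inj₁ wC3^j≡0        = wC3^j≡0
    ... | inj₂ (inj₁ wC3^j≡1) = ⊥-elim (Q₃≢0 j j<b (factor≡0 j 1 wC3^j≡1 (mod-≡ refl)))
    ... | inj₂ (inj₂ wC3^j≡2) = ⊥-elim (Q₃≢0 j j<b (factor≡0 j 2 wC3^j≡2 (mod-≡ refl)))

  Q₆≡0⇒w≡0 : (∀ r → e r ≡ w choose r modulo 6) → ∀ a b → Q₆ e a b ≡ 0 modulo 6 →
             w < 2 ^ a * 3 ^ b → w ≡ 0
  Q₆≡0⇒w≡0 e≡wCr a b Q₆≡0 = 2^a∣w∧3^b∣w∧w<2^a*3^b⇒w≡0 {a = a} {b = b}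
    (Q₂≡0⇒2^a∣w (λ r → ≡-mod-∣ 2∣6 (e≡wCr r)) a
      (≡-mod-trans (≡-mod-sym (Q₆≡Q₂-mod-2 e a b)) (≡-mod-∣ 2∣6 Q₆≡0)))
    (Q₃≡0⇒3^b∣w (λ r → ≡-mod-∣ 3∣6 (e≡wCr r)) b
      (≡-mod-trans (≡-mod-sym (Q₆≡Q₃-mod-3 e a b)) (≡-mod-∣ 3∣6 Q₆≡0)))
    where
    2∣6 : 2 ∣ 6
    2∣6 = divides 3 refl
    3∣6 : 3 ∣ 6
    3∣6 = divides 2 refl

toℕ-mod : ∀ n → toℕ (n mod 6) ≡ n modulo 6
toℕ-mod n = mod-≡ (trans (cong (_% 6) (toℕ-fromℕ< (m%n<n n 6))) (m%n%n≡m%n n 6))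

Σℕ : (m : ℕ) → (Fin m → ℕ) → ℕ
Σℕ zero    f = 0
Σℕ (suc m) f = f Fin.zero + Σℕ m (λ i → f (Fin.suc i))

toℕ-+₆ : ∀ g h → toℕ (g +₆ h) ≡ toℕ g + toℕ h modulo 6
toℕ-+₆ g h = toℕ-mod (toℕ g + toℕ h)

toℕ-*₆ : ∀ g h → toℕ (g *₆ h) ≡ toℕ g * toℕ h modulo 6
toℕ-*₆ g h = toℕ-mod (toℕ g * toℕ h)

Σℕ-cong-mod : .{{_ : NonZero n}} → ∀ m {f g : Fin m → ℕ} →
              (∀ i → f i ≡ g i modulo n) → Σℕ m f ≡ Σℕ m g modulo n
Σℕ-cong-mod zero    f≡g = ≡-mod-refl
Σℕ-cong-mod (suc m) f≡g = +-cong-mod (f≡g Fin.zero) (Σℕ-cong-mod m (λ i → f≡g (Fin.suc i)))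

toℕ-Σ₆ : ∀ m (f : Fin m → ℤ₆) → toℕ (Σ₆ m f) ≡ Σℕ m (λ i → toℕ (f i)) modulo 6
toℕ-Σ₆ zero    f = ≡-mod-refl
toℕ-Σ₆ (suc m) f = ≡-mod-trans (toℕ-+₆ (f Fin.zero) (Σ₆ m (λ i → f (Fin.suc i))))
                               (+-congˡ-mod (toℕ (f Fin.zero)) (toℕ-Σ₆ m (λ i → f (Fin.suc i))))

Σℕ-cong : ∀ m {f g : Fin m → ℕ} → (∀ i → f i ≡ g i) → Σℕ m f ≡ Σℕ m g
Σℕ-cong zero    f≡g = refl
Σℕ-cong (suc m) f≡g = cong₂ _+_ (f≡g Fin.zero) (Σℕ-cong m (λ i → f≡g (Fin.suc i)))

Σℕ-0 : ∀ m → Σℕ m (λ _ → 0) ≡ 0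
Σℕ-0 zero    = refl
Σℕ-0 (suc m) = Σℕ-0 m

Σℕ-+ : ∀ m n (f : Fin (m + n) → ℕ) →
       Σℕ (m + n) f ≡ Σℕ m (λ i → f (i ↑ˡ n)) + Σℕ n (λ i → f (m ↑ʳ i))
Σℕ-+ zero    n f = refl
Σℕ-+ (suc m) n f =
  trans (cong (f Fin.zero +_) (Σℕ-+ m n (λ i → f (Fin.suc i)))) (sym (+-assoc (f Fin.zero) _ _))

δ : Fin k → Fin k → ℕ
δ Fin.zero    Fin.zero    = 1
δ Fin.zero    (Fin.suc _) = 0
δ (Fin.suc _) Fin.zero    = 0
δ (Fin.suc i) (Fin.suc j) = δ i j

Σℕ-δ : ∀ k (i : Fin k) (h : Fin k → ℕ) → Σℕ k (λ j → δ i j * h j) ≡ h i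
Σℕ-δ (suc k) Fin.zero    h = trans (cong₂ _+_ (+-identityʳ (h Fin.zero)) (Σℕ-0 k)) (+-identityʳ _)
Σℕ-δ (suc k) (Fin.suc i) h = Σℕ-δ k i (λ j → h (Fin.suc j))

toℕ-eval₂ : ∀ {m} c l q (z : Vector ℤ₆ m) →
  toℕ (eval₂ (poly₂ c l q) z) ≡
  toℕ c + Σℕ m (λ i → toℕ (l i) * toℕ (z i))
        + Σℕ m (λ i → Σℕ m (λ j → toℕ (q i j) * toℕ (z i) * toℕ (z j))) modulo 6
toℕ-eval₂ {m} c l q z = begin
  toℕ (c +₆ Σ₆ m linearTerm +₆ Σ₆ m quadraticRow)
    ≈⟨ toℕ-+₆ (c +₆ Σ₆ m linearTerm) (Σ₆ m quadraticRow) ⟩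
  toℕ (c +₆ Σ₆ m linearTerm) + toℕ (Σ₆ m quadraticRow)
    ≈⟨ +-cong-mod (toℕ-+₆ c (Σ₆ m linearTerm)) (toℕ-Σ₆ m quadraticRow) ⟩
  toℕ c + toℕ (Σ₆ m linearTerm) + Σℕ m (λ i → toℕ (quadraticRow i))
    ≈⟨ +-cong-mod (+-congˡ-mod (toℕ c) (toℕ-Σ₆ m linearTerm))
                  (Σℕ-cong-mod m (λ i → toℕ-Σ₆ m (quadraticTerm i))) ⟩
  toℕ c + Σℕ m (λ i → toℕ (linearTerm i)) + Σℕ m (λ i → Σℕ m (λ j → toℕ (quadraticTerm i j)))
    ≈⟨ +-cong-mod (+-congˡ-mod (toℕ c) (Σℕ-cong-mod m (λ i → toℕ-*₆ (l i) (z i))))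
                  (Σℕ-cong-mod m (λ i → Σℕ-cong-mod m (λ j → toℕ-quadraticTerm i j))) ⟩
  toℕ c + Σℕ m (λ i → toℕ (l i) * toℕ (z i))
        + Σℕ m (λ i → Σℕ m (λ j → toℕ (q i j) * toℕ (z i) * toℕ (z j))) ∎
  where
  open ≡-mod-Reasoning 6
  linearTerm : Fin m → ℤ₆
  linearTerm i = l i *₆ z i
  quadraticTerm : Fin m → Fin m → ℤ₆
  quadraticTerm i j = q i j *₆ z i *₆ z j
  quadraticRow : Fin m → ℤ₆
  quadraticRow i = Σ₆ m (quadraticTerm i)
  toℕ-quadraticTerm : ∀ i j → toℕ (quadraticTerm i j) ≡ toℕ (q i j) * toℕ (z i) * toℕ (z j) modulo 6
  toℕ-quadraticTerm i j =
    ≡-mod-trans (toℕ-*₆ (q i j *₆ z i) (z j)) (*-cong-mod (toℕ-*₆ (q i j) (z i)) ≡-mod-refl)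

innerProduct : (k : ℕ) → Poly₂ (k + k)
innerProduct k = poly₂ 0₆ (λ _ → 0₆) (λ i j → pairing (splitAt k i) (splitAt k j))
  where
  pairing : Fin k ⊎ Fin k → Fin k ⊎ Fin k → ℤ₆
  pairing (inj₁ i) (inj₂ j) = δ i j mod 6
  pairing _        _        = 0₆

toℕ-eval₂-innerProduct : ∀ k (u v : Vector ℤ₆ k) →
  toℕ (eval₂ (innerProduct k) (u ++ v)) ≡ Σℕ k (λ i → toℕ (u i) * toℕ (v i)) modulo 6
toℕ-eval₂-innerProduct k u v = begin
  toℕ (eval₂ (innerProduct k) z)
    ≈⟨ toℕ-eval₂ 0₆ (λ _ → 0₆) (Poly₂.quad (innerProduct k)) z ⟩
  0 + Σℕ (k + k) (λ _ → 0) + Σℕ (k + k) (λ i → Σℕ (k + k) (term i))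
    ≡⟨ cong (_+ Σℕ (k + k) (λ i → Σℕ (k + k) (term i))) (Σℕ-0 (k + k)) ⟩
  Σℕ (k + k) (λ i → Σℕ (k + k) (term i))
    ≡⟨ Σℕ-+ k k (λ i → Σℕ (k + k) (term i)) ⟩
  Σℕ k (λ i → Σℕ (k + k) (term (i ↑ˡ k))) + Σℕ k (λ i → Σℕ (k + k) (term (k ↑ʳ i)))
    ≈⟨ +-cong-mod (Σℕ-cong-mod k row-↑ˡ) (≡⇒≡-mod (trans (Σℕ-cong k row-↑ʳ) (Σℕ-0 k))) ⟩
  Σℕ k (λ i → toℕ (u i) * toℕ (v i)) + 0
    ≡⟨ +-identityʳ _ ⟩
  Σℕ k (λ i → toℕ (u i) * toℕ (v i)) ∎
  where
  open ≡-mod-Reasoning 6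
  z = u ++ v
  term : Fin (k + k) → Fin (k + k) → ℕ
  term i j = toℕ (Poly₂.quad (innerProduct k) i j) * toℕ (z i) * toℕ (z j)
  term-↑ˡ-↑ˡ : ∀ i j → term (i ↑ˡ k) (j ↑ˡ k) ≡ 0
  term-↑ˡ-↑ˡ i j rewrite splitAt-↑ˡ k i k | splitAt-↑ˡ k j k = refl
  term-↑ˡ-↑ʳ : ∀ i j → term (i ↑ˡ k) (k ↑ʳ j) ≡ δ i j * (toℕ (u i) * toℕ (v j)) modulo 6
  term-↑ˡ-↑ʳ i j rewrite splitAt-↑ˡ k i k | splitAt-↑ʳ k k j =
    ≡-mod-trans (*-cong-mod (*-cong-mod (toℕ-mod (δ i j)) ≡-mod-refl) ≡-mod-refl)
                (≡⇒≡-mod (*-assoc (δ i j) _ _))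
  term-↑ʳ : ∀ i j → term (k ↑ʳ i) j ≡ 0
  term-↑ʳ i j rewrite splitAt-↑ʳ k k i = refl
  row-↑ˡ : ∀ i → Σℕ (k + k) (term (i ↑ˡ k)) ≡ toℕ (u i) * toℕ (v i) modulo 6
  row-↑ˡ i = begin
    Σℕ (k + k) (term (i ↑ˡ k))
      ≡⟨ Σℕ-+ k k (term (i ↑ˡ k)) ⟩
    Σℕ k (λ j → term (i ↑ˡ k) (j ↑ˡ k)) + Σℕ k (λ j → term (i ↑ˡ k) (k ↑ʳ j))
      ≈⟨ +-cong-mod (≡⇒≡-mod (trans (Σℕ-cong k (term-↑ˡ-↑ˡ i)) (Σℕ-0 k)))
                    (Σℕ-cong-mod k (term-↑ˡ-↑ʳ i)) ⟩
    Σℕ k (λ j → δ i j * (toℕ (u i) * toℕ (v j)))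
      ≡⟨ Σℕ-δ k i (λ j → toℕ (u i) * toℕ (v j)) ⟩
    toℕ (u i) * toℕ (v i) ∎
  row-↑ʳ : ∀ i → Σℕ (k + k) (term (k ↑ʳ i)) ≡ 0
  row-↑ʳ i = trans (Σℕ-cong (k + k) (term-↑ʳ i)) (Σℕ-0 (k + k))

isZero : ℤ₆ → Bool
isZero v = toℕ v ≡ᵇ 0

isZero≡EQ : ∀ {n} (v : ℤ₆) (x y : Vec Bool n) →
            (toℕ v ≡ 0 modulo 6 → x ≡ y) → (x ≡ y → toℕ v ≡ 0 modulo 6) → isZero v ≡ EQ x y
isZero≡EQ v x y ≡0⇒≡ ≡⇒≡0 = decide (≡-dec _≟ᴮ_ x y)
  where
  toℕ-v≡0 : toℕ v ≡ 0 modulo 6 → toℕ v ≡ 0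
  toℕ-v≡0 (mod-≡ v%6≡0) = trans (sym (m<n⇒m%n≡m (toℕ<n v))) v%6≡0
  decide : (x≟y : Dec (x ≡ y)) → isZero v ≡ ⌊ x≟y ⌋
  decide (yes x≡y) = cong (_≡ᵇ 0) (toℕ-v≡0 (≡⇒≡0 x≡y))
  decide (no  x≢y) with toℕ v
  ... | zero  = ⊥-elim (x≢y (≡0⇒≡ ≡-mod-refl))
  ... | suc _ = refl

module SeparableSums (X Y : Set) where

  -- [(f₁ , g₁), …, (f_k , g_k)] stands for λ x y → Σᵢ fᵢ x * gᵢ y; k is the number of ℤ₆ entries
  -- each party sends.
  Separable : Set
  Separable = List ((X → ℕ) × (Y → ℕ))

  ⟦_⟧ : Separable → X → Y → ℕ
  ⟦ []          ⟧ x y = 0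
  ⟦ (f , g) ∷ s ⟧ x y = f x * g y + ⟦ s ⟧ x y

  infixl 6 _⊕_
  _⊕_ : Separable → Separable → Separable
  _⊕_ = List._++_

  ⟦⊕⟧ : ∀ s t x y → ⟦ s ⊕ t ⟧ x y ≡ ⟦ s ⟧ x y + ⟦ t ⟧ x y
  ⟦⊕⟧ []            t x y = refl
  ⟦⊕⟧ ((f , g) ∷ s) t x y = trans (cong (f x * g y +_) (⟦⊕⟧ s t x y)) (sym (+-assoc (f x * g y) _ _))

  const : ℕ → Separable
  const c = ((λ _ → c) , (λ _ → 1)) ∷ []

  ⟦const⟧ : ∀ c x y → ⟦ const c ⟧ x y ≡ c
  ⟦const⟧ c x y = trans (+-identityʳ _) (*-identityʳ c)

  _◃_ : (X → ℕ) × (Y → ℕ) → Separable → Separable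
  (f , g) ◃ t = map (λ (f′ , g′) → (λ x → f x * f′ x) , (λ y → g y * g′ y)) t

  ⟦◃⟧ : ∀ f g t x y → ⟦ (f , g) ◃ t ⟧ x y ≡ f x * g y * ⟦ t ⟧ x y
  ⟦◃⟧ f g []              x y = sym (*-zeroʳ (f x * g y))
  ⟦◃⟧ f g ((f′ , g′) ∷ t) x y =
    trans (cong (f x * f′ x * (g y * g′ y) +_) (⟦◃⟧ f g t x y))
          (interchange (f x) (g y) (f′ x) (g′ y) (⟦ t ⟧ x y))
    where
    interchange : ∀ a b c d e → a * c * (b * d) + a * b * e ≡ a * b * (c * d + e)
    interchange = solve-∀

  infixl 7 _⊗_
  _⊗_ : Separable → Separable → Separable
  []      ⊗ t = []
  (h ∷ s) ⊗ t = h ◃ t ⊕ s ⊗ t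

  ⟦⊗⟧ : ∀ s t x y → ⟦ s ⊗ t ⟧ x y ≡ ⟦ s ⟧ x y * ⟦ t ⟧ x y
  ⟦⊗⟧ []            t x y = refl
  ⟦⊗⟧ ((f , g) ∷ s) t x y = begin
    ⟦ (f , g) ◃ t ⊕ s ⊗ t ⟧ x y
      ≡⟨ ⟦⊕⟧ ((f , g) ◃ t) (s ⊗ t) x y ⟩
    ⟦ (f , g) ◃ t ⟧ x y + ⟦ s ⊗ t ⟧ x y
      ≡⟨ cong₂ _+_ (⟦◃⟧ f g t x y) (⟦⊗⟧ s t x y) ⟩
    f x * g y * ⟦ t ⟧ x y + ⟦ s ⟧ x y * ⟦ t ⟧ x y
      ≡⟨ *-distribʳ-+ (⟦ t ⟧ x y) (f x * g y) (⟦ s ⟧ x y) ⟨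
    (f x * g y + ⟦ s ⟧ x y) * ⟦ t ⟧ x y ∎
    where open ≡-Reasoning

  length-⊗ : ∀ s t → length (s ⊗ t) ≡ length s * length t
  length-⊗ []      t = refl
  length-⊗ (h ∷ s) t = trans (length-++ (h ◃ t)) (cong₂ _+_ (length-map _ t) (length-⊗ s t))

  infixl 7 _⊙_
  _⊙_ : ℕ → Separable → Separable
  c ⊙ s = const c ⊗ s

  ⟦⊙⟧ : ∀ c s x y → ⟦ c ⊙ s ⟧ x y ≡ c * ⟦ s ⟧ x y
  ⟦⊙⟧ c s x y = trans (⟦⊗⟧ (const c) s x y) (cong (_* ⟦ s ⟧ x y) (⟦const⟧ c x y))

  length-⊙ : ∀ c s → length (c ⊙ s) ≡ length s
  length-⊙ c s = trans (length-⊗ (const c) s) (+-identityʳ _)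

  ∏ₛ : ℕ → (ℕ → Separable) → Separable
  ∏ₛ zero    f = const 1
  ∏ₛ (suc a) f = ∏ₛ a f ⊗ f a

  ⟦∏ₛ⟧ : ∀ a f x y → ⟦ ∏ₛ a f ⟧ x y ≡ ∏< a (λ j → ⟦ f j ⟧ x y)
  ⟦∏ₛ⟧ zero    f x y = ⟦const⟧ 1 x y
  ⟦∏ₛ⟧ (suc a) f x y = trans (⟦⊗⟧ (∏ₛ a f) (f a) x y) (cong (_* ⟦ f a ⟧ x y) (⟦∏ₛ⟧ a f x y))

  length-∏ₛ : ∀ a f → length (∏ₛ a f) ≡ ∏< a (λ j → length (f j))
  length-∏ₛ zero    f = refl
  length-∏ₛ (suc a) f = trans (length-⊗ (∏ₛ a f) (f a)) (cong (_* length (f a)) (length-∏ₛ a f))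

  esymₛ : ℕ → List Separable → Separable
  esymₛ zero    _        = const 1
  esymₛ (suc r) []       = []
  esymₛ (suc r) (z ∷ zs) = esymₛ (suc r) zs ⊕ z ⊗ esymₛ r zs

  esyms : List Separable → X → Y → ℕ → ℕ
  esyms zs x y r = esym r (map (λ z → ⟦ z ⟧ x y) zs)

  ⟦esymₛ⟧ : ∀ r zs x y → ⟦ esymₛ r zs ⟧ x y ≡ esyms zs x y r
  ⟦esymₛ⟧ zero    zs       x y = ⟦const⟧ 1 x y
  ⟦esymₛ⟧ (suc r) []       x y = refl
  ⟦esymₛ⟧ (suc r) (z ∷ zs) x y = begin
    ⟦ esymₛ (suc r) zs ⊕ z ⊗ esymₛ r zs ⟧ x y           ≡⟨ ⟦⊕⟧ (esymₛ (suc r) zs) _ x y ⟩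
    ⟦ esymₛ (suc r) zs ⟧ x y + ⟦ z ⊗ esymₛ r zs ⟧ x y   ≡⟨ cong (_ +_) (⟦⊗⟧ z (esymₛ r zs) x y) ⟩
    ⟦ esymₛ (suc r) zs ⟧ x y + ⟦ z ⟧ x y * ⟦ esymₛ r zs ⟧ x y
      ≡⟨ cong₂ (λ s t → s + ⟦ z ⟧ x y * t) (⟦esymₛ⟧ (suc r) zs x y) (⟦esymₛ⟧ r zs x y) ⟩
    esyms (z ∷ zs) x y (suc r)                          ∎
    where open ≡-Reasoning

  length-esymₛ : ∀ r zs → length (esymₛ r zs) ≤ sum (map length zs) ^ r
  length-esymₛ zero    zs       = ≤-refl
  length-esymₛ (suc r) []       = z≤n
  length-esymₛ (suc r) (z ∷ zs) = begin
    length (esymₛ (suc r) zs ⊕ z ⊗ esymₛ r zs)          ≡⟨ length-++ (esymₛ (suc r) zs) ⟩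
    length (esymₛ (suc r) zs) + length (z ⊗ esymₛ r zs) ≡⟨ cong (_ +_) (length-⊗ z (esymₛ r zs)) ⟩
    length (esymₛ (suc r) zs) + length z * length (esymₛ r zs)
      ≤⟨ +-mono-≤ (length-esymₛ (suc r) zs) (*-monoʳ-≤ (length z) (length-esymₛ r zs)) ⟩
    S * S ^ r + length z * S ^ r                        ≡⟨ *-distribʳ-+ (S ^ r) S (length z) ⟨
    (S + length z) * S ^ r
      ≤⟨ *-monoʳ-≤ (S + length z) (^-monoˡ-≤ r (m≤m+n S (length z))) ⟩
    (S + length z) * (S + length z) ^ r                 ≡⟨ cong (λ t → t * t ^ r) (+-comm S (length z)) ⟩
    (length z + S) ^ suc r                              ∎
    where
    open ≤-Reasoning
    S = sum (map length zs)

  Q₂ₛ : ℕ → List Separable → Separable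
  Q₂ₛ a zs = const 1 ⊕ ∏ₛ a (λ j → const 1 ⊕ esymₛ (2 ^ j) zs)

  Q₃ₛ : ℕ → List Separable → Separable
  Q₃ₛ b zs = const 1 ⊕ 2 ⊙ ∏ₛ b (λ j → const 1 ⊕ 2 ⊙ (esymₛ (3 ^ j) zs ⊗ esymₛ (3 ^ j) zs))

  Q₆ₛ : ℕ → ℕ → List Separable → Separable
  Q₆ₛ a b zs = 3 ⊙ Q₂ₛ a zs ⊕ 4 ⊙ Q₃ₛ b zs

  module _ (zs : List Separable) (x : X) (y : Y) where

    private
      e : ℕ → ℕ
      e = esyms zs x y

      ⟦1⊕⟧ : ∀ s {v} → ⟦ s ⟧ x y ≡ v → ⟦ const 1 ⊕ s ⟧ x y ≡ 1 + v
      ⟦1⊕⟧ s ⟦s⟧≡v = trans (⟦⊕⟧ (const 1) s x y) (cong₂ _+_ (⟦const⟧ 1 x y) ⟦s⟧≡v)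

      ⟦c⊙⟧ : ∀ c s {v} → ⟦ s ⟧ x y ≡ v → ⟦ c ⊙ s ⟧ x y ≡ c * v
      ⟦c⊙⟧ c s ⟦s⟧≡v = trans (⟦⊙⟧ c s x y) (cong (c *_) ⟦s⟧≡v)

    ⟦Q₂ₛ⟧ : ∀ a → ⟦ Q₂ₛ a zs ⟧ x y ≡ Q₂ (esyms zs x y) a
    ⟦Q₂ₛ⟧ a = ⟦1⊕⟧ (∏ₛ a F)
      (trans (⟦∏ₛ⟧ a F x y) (∏<-cong a (λ j → ⟦1⊕⟧ (E j) (⟦esymₛ⟧ (2 ^ j) zs x y))))
      where
      E : ℕ → Separable
      E j = esymₛ (2 ^ j) zs
      F : ℕ → Separable
      F j = const 1 ⊕ E j

    ⟦Q₃ₛ⟧ : ∀ b → ⟦ Q₃ₛ b zs ⟧ x y ≡ Q₃ (esyms zs x y) b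
    ⟦Q₃ₛ⟧ b = ⟦1⊕⟧ (2 ⊙ ∏ₛ b F)
      (⟦c⊙⟧ 2 (∏ₛ b F) (trans (⟦∏ₛ⟧ b F x y) (∏<-cong b ⟦F⟧)))
      where
      E : ℕ → Separable
      E j = esymₛ (3 ^ j) zs
      F : ℕ → Separable
      F j = const 1 ⊕ 2 ⊙ (E j ⊗ E j)
      ⟦F⟧ : ∀ j → ⟦ F j ⟧ x y ≡ 1 + 2 * (e (3 ^ j) * e (3 ^ j))
      ⟦F⟧ j = ⟦1⊕⟧ (2 ⊙ (E j ⊗ E j)) (⟦c⊙⟧ 2 (E j ⊗ E j) (trans (⟦⊗⟧ (E j) (E j) x y)
                (cong₂ _*_ (⟦esymₛ⟧ (3 ^ j) zs x y) (⟦esymₛ⟧ (3 ^ j) zs x y))))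

    ⟦Q₆ₛ⟧ : ∀ a b → ⟦ Q₆ₛ a b zs ⟧ x y ≡ Q₆ (esyms zs x y) a b
    ⟦Q₆ₛ⟧ a b = trans (⟦⊕⟧ (3 ⊙ Q₂ₛ a zs) _ x y)
      (cong₂ _+_ (⟦c⊙⟧ 3 (Q₂ₛ a zs) (⟦Q₂ₛ⟧ a)) (⟦c⊙⟧ 4 (Q₃ₛ b zs) (⟦Q₃ₛ⟧ b)))

  module _ {T} .{{_ : NonZero T}} {zs : List Separable} (S≤T : sum (map length zs) ≤ T) where

    private
      length-esymₛ≤ : ∀ r → length (esymₛ r zs) ≤ T ^ r
      length-esymₛ≤ r = ≤-trans (length-esymₛ r zs) (^-monoˡ-≤ r S≤T)

    length-Q₂ₛ : ∀ a → length (Q₂ₛ a zs) ≤ 1 + 2 ^ a * T ^ (2 ^ a)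
    length-Q₂ₛ a = s≤s (≤-trans (≤-reflexive (length-∏ₛ a _)) (∏<-bound 1 a _ (λ j →
      s≤s (subst (λ t → length (esymₛ (2 ^ j) zs) ≤ T ^ t) (sym (*-identityˡ (2 ^ j)))
                 (length-esymₛ≤ (2 ^ j))))))

    length-Q₃ₛ : ∀ b → length (Q₃ₛ b zs) ≤ 1 + 2 ^ b * T ^ (3 ^ b)
    length-Q₃ₛ b = s≤s (begin
      length (2 ⊙ ∏ₛ b _)                        ≡⟨ trans (length-⊙ 2 (∏ₛ b _)) (length-∏ₛ b _) ⟩
      ∏< b (λ j → suc (length (2 ⊙ (E j ⊗ E j)))) ≤⟨ ∏<-bound 2 b _ factor≤ ⟩
      2 ^ b * T ^ (3 ^ b)                        ∎)
      where
      open ≤-Reasoning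
      E : ℕ → Separable
      E j = esymₛ (3 ^ j) zs
      factor≤ : ∀ j → suc (length (2 ⊙ (E j ⊗ E j))) ≤ 1 + T ^ (2 * 3 ^ j)
      factor≤ j = s≤s (begin
        length (2 ⊙ (E j ⊗ E j))          ≡⟨ trans (length-⊙ 2 (E j ⊗ E j)) (length-⊗ (E j) (E j)) ⟩
        length (E j) * length (E j)       ≤⟨ *-mono-≤ (length-esymₛ≤ (3 ^ j)) (length-esymₛ≤ (3 ^ j)) ⟩
        T ^ (3 ^ j) * T ^ (3 ^ j)         ≡⟨ ^-distribˡ-+-* T (3 ^ j) (3 ^ j) ⟨
        T ^ (3 ^ j + 3 ^ j)               ≡⟨ cong (λ t → T ^ (3 ^ j + t)) (+-identityʳ (3 ^ j)) ⟨
        T ^ (2 * 3 ^ j)                   ∎)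

    length-Q₆ₛ : ∀ a b → length (Q₆ₛ a b zs) ≤ (1 + 2 ^ a * T ^ (2 ^ a)) + (1 + 2 ^ b * T ^ (3 ^ b))
    length-Q₆ₛ a b = begin
      length (3 ⊙ Q₂ₛ a zs ⊕ 4 ⊙ Q₃ₛ b zs)   ≡⟨ length-++ (3 ⊙ Q₂ₛ a zs) ⟩
      length (3 ⊙ Q₂ₛ a zs) + length (4 ⊙ Q₃ₛ b zs)
        ≡⟨ cong₂ _+_ (length-⊙ 3 (Q₂ₛ a zs)) (length-⊙ 4 (Q₃ₛ b zs)) ⟩
      length (Q₂ₛ a zs) + length (Q₃ₛ b zs)  ≤⟨ +-mono-≤ (length-Q₂ₛ a) (length-Q₃ₛ b) ⟩
      (1 + 2 ^ a * T ^ (2 ^ a)) + (1 + 2 ^ b * T ^ (3 ^ b)) ∎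
      where open ≤-Reasoning

  left : (s : Separable) → X → Vector ℤ₆ (length s)
  left s x i = proj₁ (List.lookup s i) x mod 6

  right : (s : Separable) → Y → Vector ℤ₆ (length s)
  right s y i = proj₂ (List.lookup s i) y mod 6

  Σℕ-left*right : ∀ s x y →
    Σℕ (length s) (λ i → toℕ (left s x i) * toℕ (right s y i)) ≡ ⟦ s ⟧ x y modulo 6
  Σℕ-left*right []            x y = ≡-mod-refl
  Σℕ-left*right ((f , g) ∷ s) x y =
    +-cong-mod (*-cong-mod (toℕ-mod (f x)) (toℕ-mod (g y))) (Σℕ-left*right s x y)

  toℕ-eval₂-left-right : ∀ s x y →
    toℕ (eval₂ (innerProduct (length s)) (left s x ++ right s y)) ≡ ⟦ s ⟧ x y modulo 6
  toℕ-eval₂-left-right s x y =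
    ≡-mod-trans (toℕ-eval₂-innerProduct (length s) (left s x) (right s y)) (Σℕ-left*right s x y)

module Chunking {A : Set} (t : ℕ) where

  -- Pieces of length at most suc t; the fuel only has to bound the length of the list.
  chunks : ℕ → List A → List (List A)
  chunks zero    xs       = []
  chunks (suc f) []       = []
  chunks (suc f) (x ∷ xs) = take (suc t) (x ∷ xs) ∷ chunks f (drop t xs)

  chunks-[] : ∀ f → chunks f [] ≡ []
  chunks-[] zero    = refl
  chunks-[] (suc f) = refl

  length-drop≤ : ∀ (xs : List A) → length (drop t xs) ≤ length xs
  length-drop≤ xs = ≤-trans (≤-reflexive (length-drop t xs)) (m∸n≤m (length xs) t)

  ∈-chunks : ∀ f (xs : List A) → length xs ≤ f → ∀ {v} → v ∈ xs → ∃[ c ] (c ∈ chunks f xs × v ∈ c)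
  ∈-chunks (suc f) (x ∷ xs) (s≤s xs≤f) {v} v∈x∷xs
    with ∈-++⁻ (take (suc t) (x ∷ xs)) (subst (v ∈_) (sym (take++drop≡id (suc t) (x ∷ xs))) v∈x∷xs)
  ... | inj₁ v∈take = _ , here refl , v∈take
  ... | inj₂ v∈drop with ∈-chunks f (drop t xs) (≤-trans (length-drop≤ xs) xs≤f) v∈drop
  ...   | c , c∈chunks , v∈c = c , there c∈chunks , v∈c

  length-∈-chunks : ∀ f (xs : List A) {c} → c ∈ chunks f xs → length c ≤ suc t
  length-∈-chunks (suc f) (x ∷ xs) (here refl) =
    ≤-trans (≤-reflexive (length-take (suc t) (x ∷ xs))) (m⊓n≤m (suc t) _)
  length-∈-chunks (suc f) (x ∷ xs) (there c∈chunks) = length-∈-chunks f (drop t xs) c∈chunks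

  length-chunks≤ : ∀ f (xs : List A) → length (chunks f xs) ≤ length xs
  length-chunks≤ zero    xs       = z≤n
  length-chunks≤ (suc f) []       = z≤n
  length-chunks≤ (suc f) (x ∷ xs) = s≤s (≤-trans (length-chunks≤ f (drop t xs)) (length-drop≤ xs))

  *-length-chunks≤ : ∀ f (xs : List A) → length xs ≤ f → suc t * length (chunks f xs) ≤ length xs + suc t
  *-length-chunks≤ zero    []       _ = ≤-trans (≤-reflexive (*-zeroʳ (suc t))) z≤n
  *-length-chunks≤ (suc f) []       _ = ≤-trans (≤-reflexive (*-zeroʳ (suc t))) z≤n
  *-length-chunks≤ (suc f) (x ∷ xs) (s≤s xs≤f) with drop t xs in drop≡
  ... | [] rewrite chunks-[] f = ≤-trans (≤-reflexive (*-identityʳ (suc t))) (m≤n+m (suc t) (suc (length xs)))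
  ... | y ∷ ys = begin
    suc t * suc (length (chunks f (y ∷ ys)))   ≡⟨ *-suc (suc t) _ ⟩
    suc t + suc t * length (chunks f (y ∷ ys)) ≤⟨ +-monoʳ-≤ (suc t) (*-length-chunks≤ f (y ∷ ys) y∷ys≤f) ⟩
    suc t + (length (y ∷ ys) + suc t)          ≡⟨ cong (λ l → suc t + (l + suc t)) length-y∷ys ⟩
    suc t + (length xs ∸ t + suc t)
      ≡⟨ cong (suc t +_) (trans (+-suc (length xs ∸ t) t) (cong suc (m∸n+n≡m t≤xs))) ⟩
    suc t + suc (length xs)                    ≡⟨ +-comm (suc t) _ ⟩
    suc (length xs) + suc t                    ∎
    where
    open ≤-Reasoning
    length-y∷ys : length (y ∷ ys) ≡ length xs ∸ t
    length-y∷ys = trans (cong length (sym drop≡)) (length-drop t xs)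
    t≤xs : t ≤ length xs
    t≤xs = <⇒≤ (m∸n≢0⇒n<m (λ xs∸t≡0 → case trans length-y∷ys xs∸t≡0 of λ ()))
    y∷ys≤f : length (y ∷ ys) ≤ f
    y∷ys≤f = subst (λ l → length l ≤ f) drop≡ (≤-trans (length-drop≤ xs) xs≤f)

bit : Bool → ℕ
bit false = 0
bit true  = 1

agree : Bool → Bool → ℕ
agree false false = 1
agree true  true  = 1
agree _     _     = 0

agree-refl : ∀ s → agree s s ≡ 1
agree-refl false = refl
agree-refl true  = refl

agree-≢ : ∀ {s t} → s ≢ t → agree s t ≡ 0
agree-≢ {false} {false} s≢t = ⊥-elim (s≢t refl)
agree-≢ {false} {true}  _   = refl
agree-≢ {true}  {false} _   = refl
agree-≢ {true}  {true}  s≢t = ⊥-elim (s≢t refl)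

agree≤1 : ∀ s t → agree s t ≤ 1
agree≤1 false false = ≤-refl
agree≤1 false true  = z≤n
agree≤1 true  false = z≤n
agree≤1 true  true  = ≤-refl

∃-lookup-≢ : ∀ {n} {x y : Vec Bool n} → x ≢ y → ∃[ l ] (Vec.lookup x l ≢ Vec.lookup y l)
∃-lookup-≢ {x = Vec.[]}    {Vec.[]}    x≢y = ⊥-elim (x≢y refl)
∃-lookup-≢ {x = s Vec.∷ x} {t Vec.∷ y} x≢y with s ≟ᴮ t
... | no s≢t    = Fin.zero , s≢t
... | yes refl with ∃-lookup-≢ (λ x≡y → x≢y (cong (s Vec.∷_) x≡y))
...   | l , x≢y-at-l = Fin.suc l , x≢y-at-l

module Agreement (n : ℕ) where

  open SeparableSums (Vec Bool n) (Vec Bool n)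

  agreeₛ : Fin n → Separable
  agreeₛ l = ((λ x → bit (Vec.lookup x l))     , (λ y → bit (Vec.lookup y l)))
           ∷ ((λ x → 1 ∸ bit (Vec.lookup x l)) , (λ y → 1 ∸ bit (Vec.lookup y l)))
           ∷ []

  ⟦agreeₛ⟧ : ∀ l x y → ⟦ agreeₛ l ⟧ x y ≡ agree (Vec.lookup x l) (Vec.lookup y l)
  ⟦agreeₛ⟧ l x y with Vec.lookup x l | Vec.lookup y l
  ... | false | false = refl
  ... | false | true  = refl
  ... | true  | false = refl
  ... | true  | true  = refl

  agreeOnₛ : List (Fin n) → Separable
  agreeOnₛ []      = const 1
  agreeOnₛ (l ∷ c) = agreeₛ l ⊗ agreeOnₛ c

  ⟦agreeOnₛ⟧-∷ : ∀ l c x y →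
    ⟦ agreeOnₛ (l ∷ c) ⟧ x y ≡ agree (Vec.lookup x l) (Vec.lookup y l) * ⟦ agreeOnₛ c ⟧ x y
  ⟦agreeOnₛ⟧-∷ l c x y =
    trans (⟦⊗⟧ (agreeₛ l) (agreeOnₛ c) x y) (cong (_* ⟦ agreeOnₛ c ⟧ x y) (⟦agreeₛ⟧ l x y))

  ⟦agreeOnₛ⟧-refl : ∀ c x → ⟦ agreeOnₛ c ⟧ x x ≡ 1
  ⟦agreeOnₛ⟧-refl []      x = refl
  ⟦agreeOnₛ⟧-refl (l ∷ c) x
    rewrite ⟦agreeOnₛ⟧-∷ l c x x | agree-refl (Vec.lookup x l) | ⟦agreeOnₛ⟧-refl c x = refl

  ⟦agreeOnₛ⟧-≢ : ∀ c x y {l} → l ∈ c → Vec.lookup x l ≢ Vec.lookup y l → ⟦ agreeOnₛ c ⟧ x y ≡ 0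
  ⟦agreeOnₛ⟧-≢ (l ∷ c) x y (here refl) x≢y-at-l
    rewrite ⟦agreeOnₛ⟧-∷ l c x y | agree-≢ x≢y-at-l = refl
  ⟦agreeOnₛ⟧-≢ (l′ ∷ c) x y (there l∈c) x≢y-at-l
    rewrite ⟦agreeOnₛ⟧-∷ l′ c x y | ⟦agreeOnₛ⟧-≢ c x y l∈c x≢y-at-l =
    *-zeroʳ (agree (Vec.lookup x l′) (Vec.lookup y l′))

  ⟦agreeOnₛ⟧≤1 : ∀ c x y → ⟦ agreeOnₛ c ⟧ x y ≤ 1
  ⟦agreeOnₛ⟧≤1 []      x y = ≤-refl
  ⟦agreeOnₛ⟧≤1 (l ∷ c) x y rewrite ⟦agreeOnₛ⟧-∷ l c x y =
    *-mono-≤ (agree≤1 (Vec.lookup x l) (Vec.lookup y l)) (⟦agreeOnₛ⟧≤1 c x y)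

  length-agreeOnₛ : ∀ c → length (agreeOnₛ c) ≡ 2 ^ length c
  length-agreeOnₛ []      = refl
  length-agreeOnₛ (l ∷ c) = trans (length-⊗ (agreeₛ l) (agreeOnₛ c)) (cong (2 *_) (length-agreeOnₛ c))

  differOn : List (Fin n) → Vec Bool n → Vec Bool n → ℕ
  differOn c x y = 1 ∸ ⟦ agreeOnₛ c ⟧ x y

  -- 5 ≡ -1 (mod 6), and ⟦ agreeOnₛ c ⟧ x y is a bit.
  differOnₛ : List (Fin n) → Separable
  differOnₛ c = const 1 ⊕ 5 ⊙ agreeOnₛ c

  ⟦differOnₛ⟧ : ∀ c x y → ⟦ differOnₛ c ⟧ x y ≡ differOn c x y modulo 6
  ⟦differOnₛ⟧ c x y
    rewrite ⟦⊕⟧ (const 1) (5 ⊙ agreeOnₛ c) x y | ⟦const⟧ 1 x y | ⟦⊙⟧ 5 (agreeOnₛ c) x y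
    with ⟦ agreeOnₛ c ⟧ x y | ⟦agreeOnₛ⟧≤1 c x y
  ... | 0 | _ = ≡-mod-refl
  ... | 1 | _ = mod-≡ refl
  ... | suc (suc _) | s≤s ()

  length-differOnₛ : ∀ c → length (differOnₛ c) ≡ 1 + 2 ^ length c
  length-differOnₛ c = cong suc (trans (length-⊙ 5 (agreeOnₛ c)) (length-agreeOnₛ c))

  differOn≤1 : ∀ c x y → differOn c x y ≤ 1
  differOn≤1 c x y = m∸n≤m 1 (⟦ agreeOnₛ c ⟧ x y)

  #differing : List (List (Fin n)) → Vec Bool n → Vec Bool n → ℕ
  #differing cs x y = sum (map (λ c → differOn c x y) cs)

  differOn-bits : ∀ cs x y → All (_≤ 1) (map (λ c → differOn c x y) cs)
  differOn-bits cs x y = map⁺ (All.universal (λ c → differOn≤1 c x y) cs)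

  esym-differOnₛ : ∀ cs x y r → esyms (map differOnₛ cs) x y r ≡ #differing cs x y choose r modulo 6
  esym-differOnₛ cs x y r = begin
    esyms (map differOnₛ cs) x y r               ≡⟨ cong (esym r) (map-∘ cs) ⟨
    esym r (map (λ c → ⟦ differOnₛ c ⟧ x y) cs)  ≈⟨ esym-cong-mod (λ c → ⟦differOnₛ⟧ c x y) r cs ⟩
    esym r (map (λ c → differOn c x y) cs)       ≡⟨ esym-bits≡sumCr (differOn-bits cs x y) r ⟩
    #differing cs x y choose r                   ∎
    where open ≡-mod-Reasoning 6

  #differing-refl : ∀ cs x → #differing cs x x ≡ 0
  #differing-refl cs x = sum-zeros (map⁺ (All.universal (λ c → cong (1 ∸_) (⟦agreeOnₛ⟧-refl c x)) cs))

  Covers : List (List (Fin n)) → Set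
  Covers cs = ∀ l → ∃[ c ] (c ∈ cs × l ∈ c)

  #differing-≢ : ∀ cs {x y} → Covers cs → x ≢ y → 0 < #differing cs x y
  #differing-≢ cs {x} {y} covers x≢y with ∃-lookup-≢ x≢y
  ... | l , x≢y-at-l with covers l
  ...   | c , c∈cs , l∈c = ≤-trans (≤-reflexive (cong (1 ∸_) (sym (⟦agreeOnₛ⟧-≢ c x y l∈c x≢y-at-l))))
                                   (∈⇒≤sum (∈-map⁺ (λ c → differOn c x y) c∈cs))

  #differing≤length : ∀ cs x y → #differing cs x y ≤ length cs
  #differing≤length cs x y = ≤-trans (sum-bits≤length (differOn-bits cs x y))
                                     (≤-reflexive (length-map _ cs))

  equalityₛ : ℕ → ℕ → List (List (Fin n)) → Separable
  equalityₛ a b cs = Q₆ₛ a b (map differOnₛ cs)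

  ⟦equalityₛ⟧-refl : ∀ a b cs x → ⟦ equalityₛ a b cs ⟧ x x ≡ 0 modulo 6
  ⟦equalityₛ⟧-refl a b cs x =
    ≡-mod-trans (≡⇒≡-mod (⟦Q₆ₛ⟧ (map differOnₛ cs) x x a b)) (e≡0Cr⇒Q₆≡0 e≡0Cr a b)
    where
    e≡0Cr : ∀ r → esyms (map differOnₛ cs) x x r ≡ 0 choose r modulo 6
    e≡0Cr r = subst (λ w → esyms (map differOnₛ cs) x x r ≡ w choose r modulo 6) (#differing-refl cs x)
                    (esym-differOnₛ cs x x r)

  ⟦equalityₛ⟧≡0⇒≡ : ∀ a b cs {x y} → Covers cs → length cs < 2 ^ a * 3 ^ b →
                    ⟦ equalityₛ a b cs ⟧ x y ≡ 0 modulo 6 → x ≡ y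
  ⟦equalityₛ⟧≡0⇒≡ a b cs {x} {y} covers cs< ⟦eq⟧≡0 with ≡-dec _≟ᴮ_ x y
  ... | yes x≡y = x≡y
  ... | no  x≢y = ⊥-elim (<⇒≢ (#differing-≢ cs covers x≢y) (sym #differing≡0))
    where
    #differing≡0 : #differing cs x y ≡ 0
    #differing≡0 = Q₆≡0⇒w≡0 (esym-differOnₛ cs x y) a b
      (≡-mod-trans (≡⇒≡-mod (sym (⟦Q₆ₛ⟧ (map differOnₛ cs) x y a b))) ⟦eq⟧≡0)
      (≤-<-trans (#differing≤length cs x y) cs<)

n<2^n : ∀ n → n < 2 ^ n
n<2^n zero    = z<s
n<2^n (suc n) = begin-strict
  suc n         <⟨ s<s (n<2^n n) ⟩
  suc (2 ^ n)   ≤⟨ +-monoˡ-≤ (2 ^ n) (m^n>0 2 n) ⟩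
  2 ^ n + 2 ^ n ≡⟨ cong (2 ^ n +_) (+-identityʳ (2 ^ n)) ⟨
  2 ^ (suc n)   ∎
  where open ≤-Reasoning

n<3^n : ∀ n → n < 3 ^ n
n<3^n n = <-≤-trans (n<2^n n) (^-monoˡ-≤ n (s≤s (s≤s z≤n)))

4^n≡2^n*2^n : ∀ n → 4 ^ n ≡ 2 ^ n * 2 ^ n
4^n≡2^n*2^n n =
  trans (^-*-assoc 2 2 n) (trans (cong (2 ^_) (cong (n +_) (+-identityʳ n))) (^-distribˡ-+-* 2 n n))

∃-power-between : ∀ q N → ∃[ k ] (suc N ≤ (2 + q) ^ k × (2 + q) ^ k ≤ (2 + q) * suc N)
∃-power-between q zero    = 0 , ≤-refl , s≤s z≤n
∃-power-between q (suc N) with ∃-power-between q N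
... | k , N<b^k , b^k≤b*[1+N] with suc (suc N) ≤? (2 + q) ^ k
...   | yes 2+N≤b^k = k , 2+N≤b^k , ≤-trans b^k≤b*[1+N] (*-monoʳ-≤ (2 + q) (n≤1+n (suc N)))
...   | no  2+N≰b^k = suc k , 2+N≤B*B^k , *-monoʳ-≤ B (≤-trans (≤-reflexive B^k≡1+N) (n≤1+n (suc N)))
  where
  B = 2 + q
  B^k≡1+N : B ^ k ≡ suc N
  B^k≡1+N = ≤-antisym (≤-pred (≰⇒> 2+N≰b^k)) N<b^k
  2+N≤B*B^k : suc (suc N) ≤ B * B ^ k
  2+N≤B*B^k = begin
    suc (suc N)     ≤⟨ s≤s (m≤n+m (suc N) N) ⟩
    suc N + suc N   ≡⟨ cong (suc N +_) (+-identityʳ (suc N)) ⟨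
    2 * suc N       ≤⟨ *-monoˡ-≤ (suc N) {2} {B} (s≤s (s≤s z≤n)) ⟩
    B * suc N       ≡⟨ cong (B *_) B^k≡1+N ⟨
    B * B ^ k       ∎
    where open ≤-Reasoning

1+2^a+1+2^b≤2^[a+b+2] : ∀ a b → (1 + 2 ^ a) + (1 + 2 ^ b) ≤ 2 ^ (a + b + 2)
1+2^a+1+2^b≤2^[a+b+2] a b = begin
  (1 + 2 ^ a) + (1 + 2 ^ b) ≤⟨ +-mono-≤ (+-mono-≤ 1≤M (^-monoʳ-≤ 2 (m≤m+n a b)))
                                        (+-mono-≤ 1≤M (^-monoʳ-≤ 2 (m≤n+m b a))) ⟩
  (M + M) + (M + M)         ≡⟨ quadruple M ⟩
  M * 2 ^ 2                 ≡⟨ ^-distribˡ-+-* 2 (a + b) 2 ⟨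
  2 ^ (a + b + 2)           ∎
  where
  open ≤-Reasoning
  M = 2 ^ (a + b)
  1≤M : 1 ≤ M
  1≤M = m^n>0 2 (a + b)
  quadruple : ∀ M → (M + M) + (M + M) ≡ M * 4
  quadruple = solve-∀

module _ {L u v : ℕ} (1≤L : 1 ≤ L) where

  private
    κ = 2 * L + 1
    s = 2 ^ u

  exponent≤18*L*2^u : 3 ^ v ≤ 3 * s → (u + κ * s) + (v + κ * 3 ^ v) + 2 ≤ 18 * L * s
  exponent≤18*L*2^u 3^v≤3s = begin
    (u + κ * s) + (v + κ * 3 ^ v) + 2
      ≤⟨ +-mono-≤ (+-mono-≤ (+-monoˡ-≤ (κ * s) (<⇒≤ (n<2^n u))) (+-monoˡ-≤ (κ * 3 ^ v) (<⇒≤ (n<3^n v))))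
                  (*-monoʳ-≤ 2 (m^n>0 2 u)) ⟩
    (s + κ * s) + (3 ^ v + κ * 3 ^ v) + 2 * s
      ≤⟨ +-monoˡ-≤ (2 * s) (+-monoʳ-≤ (s + κ * s) (+-mono-≤ 3^v≤3s (*-monoʳ-≤ κ 3^v≤3s))) ⟩
    (s + κ * s) + (3 * s + κ * (3 * s)) + 2 * s
      ≡⟨ collect L s ⟩
    (8 * L + 10) * s
      ≤⟨ *-monoˡ-≤ s (+-monoʳ-≤ (8 * L) (*-monoʳ-≤ 10 1≤L)) ⟩
    (8 * L + 10 * L) * s
      ≡⟨ collect′ L s ⟩
    18 * L * s ∎
    where
    open ≤-Reasoning
    collect : ∀ L s → (s + (2 * L + 1) * s) + (3 * s + (2 * L + 1) * (3 * s)) + 2 * s ≡ (8 * L + 10) * s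
    collect = solve-∀
    collect′ : ∀ L s → (8 * L + 10 * L) * s ≡ 18 * L * s
    collect′ = solve-∀

  exponent²≤ : ∀ {n m} → L ≤ n → L * m ≤ n + L → s * s ≤ 4 * suc m → 3 ^ v ≤ 3 * s →
               let e = (u + κ * s) + (v + κ * 3 ^ v) + 2 in e * e ≤ 3888 * n * L
  exponent²≤ {n} {m} L≤n L*m≤n+L s*s≤4[1+m] 3^v≤3s = begin
    e * e                      ≤⟨ *-mono-≤ e≤ e≤ ⟩
    (18 * L * s) * (18 * L * s) ≡⟨ square L s ⟩
    324 * L * L * (s * s)      ≤⟨ *-monoʳ-≤ (324 * L * L) s*s≤4[1+m] ⟩
    324 * L * L * (4 * suc m)  ≡⟨ distribute L m ⟩
    1296 * L * (L * m + L)     ≤⟨ *-monoʳ-≤ (1296 * L) (+-monoˡ-≤ L L*m≤n+L) ⟩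
    1296 * L * (n + L + L)     ≤⟨ *-monoʳ-≤ (1296 * L) (+-mono-≤ (+-monoʳ-≤ n L≤n) L≤n) ⟩
    1296 * L * (n + n + n)     ≡⟨ collect L n ⟩
    3888 * n * L               ∎
    where
    open ≤-Reasoning
    e = (u + κ * s) + (v + κ * 3 ^ v) + 2
    e≤ : e ≤ 18 * L * s
    e≤ = exponent≤18*L*2^u 3^v≤3s
    square : ∀ L s → (18 * L * s) * (18 * L * s) ≡ 324 * L * L * (s * s)
    square = solve-∀
    distribute : ∀ L m → 324 * L * L * (4 * suc m) ≡ 1296 * L * (L * m + L)
    distribute = solve-∀
    collect : ∀ L n → 1296 * L * (n + n + n) ≡ 3888 * n * L
    collect = solve-∀

n≤2^⌈log₂n⌉ : ∀ n → n ≤ 2 ^ ⌈log₂ n ⌉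
n≤2^⌈log₂n⌉ n = go n (<-wellFounded n)
  where
  go : ∀ n (acc : Acc _<_ n) → n ≤ 2 ^ ⌈log2⌉ n acc
  go zero                _         = z≤n
  go (suc zero)          _         = s≤s z≤n
  go (suc (suc n)) (acc rs) = begin
    2 + n                          ≤⟨ +-monoʳ-≤ 2 n≤2*⌈n/2⌉ ⟩
    2 + 2 * ⌈ n /2⌉                ≡⟨ *-suc 2 ⌈ n /2⌉ ⟨
    2 * suc ⌈ n /2⌉                ≤⟨ *-monoʳ-≤ 2 (go (suc ⌈ n /2⌉) _) ⟩
    2 * 2 ^ ⌈log2⌉ (suc ⌈ n /2⌉) _ ∎
    where
    open ≤-Reasoning
    n≤2*⌈n/2⌉ : n ≤ 2 * ⌈ n /2⌉
    n≤2*⌈n/2⌉ = begin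
      n                  ≡⟨ ⌊n/2⌋+⌈n/2⌉≡n n ⟨
      ⌊ n /2⌋ + ⌈ n /2⌉  ≤⟨ +-monoˡ-≤ ⌈ n /2⌉ (⌊n/2⌋≤⌈n/2⌉ n) ⟩
      ⌈ n /2⌉ + ⌈ n /2⌉  ≡⟨ cong (⌈ n /2⌉ +_) (+-identityʳ ⌈ n /2⌉) ⟨
      2 * ⌈ n /2⌉        ∎

⌈log₂n⌉≤n : ∀ n → ⌈log₂ n ⌉ ≤ n
⌈log₂n⌉≤n n = ≤-trans (⌈log₂⌉-mono-≤ (<⇒≤ (n<2^n n))) (≤-reflexive (⌈log₂2^n⌉≡n n))

module Construction (n t : ℕ) (⌈log₂n⌉≡1+t : ⌈log₂ n ⌉ ≡ suc t) where

  open SeparableSums (Vec Bool n) (Vec Bool n)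
  open Agreement n
  open Chunking {Fin n} t

  L : ℕ
  L = suc t

  cs : List (List (Fin n))
  cs = chunks n (allFin n)

  #cs : ℕ
  #cs = length cs

  length-allFin : length (allFin n) ≡ n
  length-allFin = length-tabulate (λ i → i)

  covers : Covers cs
  covers l = ∈-chunks n (allFin n) (≤-reflexive length-allFin) (∈-allFin l)

  -- #cs < 4^d₂ ≤ 4 (#cs + 1) and 2^d₂ ≤ 3^d₃ ≤ 3 · 2^d₂, so #cs < 2^d₂ · 3^d₃ while
  -- 2^d₂ and 3^d₃ stay O(√#cs).
  d₂ : ℕ
  d₂ = proj₁ (∃-power-between 2 #cs)

  s : ℕ
  s = 2 ^ d₂

  d₃ : ℕ
  d₃ = proj₁ (∃-power-between 1 (pred s))

  1+pred-s≡s : suc (pred s) ≡ s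
  1+pred-s≡s = suc-pred s {{m^n≢0 2 d₂}}

  1+#cs≤s*s : suc #cs ≤ s * s
  1+#cs≤s*s = subst (suc #cs ≤_) (4^n≡2^n*2^n d₂) (proj₁ (proj₂ (∃-power-between 2 #cs)))

  s*s≤4[1+#cs] : s * s ≤ 4 * suc #cs
  s*s≤4[1+#cs] = subst (_≤ 4 * suc #cs) (4^n≡2^n*2^n d₂) (proj₂ (proj₂ (∃-power-between 2 #cs)))

  s≤3^d₃ : s ≤ 3 ^ d₃
  s≤3^d₃ = subst (_≤ 3 ^ d₃) 1+pred-s≡s (proj₁ (proj₂ (∃-power-between 1 (pred s))))

  3^d₃≤3s : 3 ^ d₃ ≤ 3 * s
  3^d₃≤3s = subst (λ h → 3 ^ d₃ ≤ 3 * h) 1+pred-s≡s (proj₂ (proj₂ (∃-power-between 1 (pred s))))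

  #cs<2^d₂*3^d₃ : #cs < 2 ^ d₂ * 3 ^ d₃
  #cs<2^d₂*3^d₃ = <-≤-trans 1+#cs≤s*s (*-monoʳ-≤ s s≤3^d₃)

  protocolₛ : Separable
  protocolₛ = equalityₛ d₂ d₃ cs

  #terms : ℕ
  #terms = length protocolₛ

  correct : ∀ x y → isZero (eval₂ (innerProduct #terms) (left protocolₛ x ++ right protocolₛ y)) ≡ EQ x y
  correct x y = isZero≡EQ _ x y
    (λ value≡0 → ⟦equalityₛ⟧≡0⇒≡ d₂ d₃ cs covers #cs<2^d₂*3^d₃
                   (≡-mod-trans (≡-mod-sym (toℕ-eval₂-left-right protocolₛ x y)) value≡0))
    (λ { refl → ≡-mod-trans (toℕ-eval₂-left-right protocolₛ x x) (⟦equalityₛ⟧-refl d₂ d₃ cs x) })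

  #cs≤2^L : #cs ≤ 2 ^ L
  #cs≤2^L = begin
    #cs               ≤⟨ length-chunks≤ n (allFin n) ⟩
    length (allFin n) ≡⟨ length-allFin ⟩
    n                 ≤⟨ n≤2^⌈log₂n⌉ n ⟩
    2 ^ ⌈log₂ n ⌉     ≡⟨ cong (2 ^_) ⌈log₂n⌉≡1+t ⟩
    2 ^ L             ∎
    where open ≤-Reasoning

  κ : ℕ
  κ = 2 * L + 1

  sum-lengths≤2^κ : sum (map length (map differOnₛ cs)) ≤ 2 ^ κ
  sum-lengths≤2^κ = begin
    sum (map length (map differOnₛ cs))       ≡⟨ cong sum (map-∘ cs) ⟨
    sum (map (λ c → length (differOnₛ c)) cs) ≤⟨ sum-map-≤ (All.tabulate length-differOnₛ≤) ⟩
    #cs * 2 ^ suc L                           ≤⟨ *-monoˡ-≤ (2 ^ suc L) #cs≤2^L ⟩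
    2 ^ L * 2 ^ suc L                         ≡⟨ ^-distribˡ-+-* 2 L (suc L) ⟨
    2 ^ (L + suc L)                           ≡⟨ cong (2 ^_) (L+1+L≡2L+1 L) ⟩
    2 ^ κ                                     ∎
    where
    open ≤-Reasoning
    L+1+L≡2L+1 : ∀ L → L + suc L ≡ 2 * L + 1
    L+1+L≡2L+1 = solve-∀
    length-differOnₛ≤ : ∀ {c} → c ∈ cs → length (differOnₛ c) ≤ 2 ^ suc L
    length-differOnₛ≤ {c} c∈cs = begin
      length (differOnₛ c)  ≡⟨ length-differOnₛ c ⟩
      1 + 2 ^ length c      ≤⟨ +-mono-≤ (m^n>0 2 L) (^-monoʳ-≤ 2 (length-∈-chunks n (allFin n) c∈cs)) ⟩
      2 ^ L + 2 ^ L         ≡⟨ cong (2 ^ L +_) (+-identityʳ (2 ^ L)) ⟨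
      2 ^ suc L             ∎

  exponent : ℕ
  exponent = (d₂ + κ * s) + (d₃ + κ * 3 ^ d₃) + 2

  #terms≤2^exponent : #terms ≤ 2 ^ exponent
  #terms≤2^exponent = begin
    #terms
      ≤⟨ length-Q₆ₛ {{m^n≢0 2 κ}} sum-lengths≤2^κ d₂ d₃ ⟩
    (1 + 2 ^ d₂ * (2 ^ κ) ^ s) + (1 + 2 ^ d₃ * (2 ^ κ) ^ (3 ^ d₃))
      ≡⟨ cong₂ (λ g h → (1 + g) + (1 + h)) (2^a*[2^κ]^b d₂ s) (2^a*[2^κ]^b d₃ (3 ^ d₃)) ⟩
    (1 + 2 ^ (d₂ + κ * s)) + (1 + 2 ^ (d₃ + κ * 3 ^ d₃))
      ≤⟨ 1+2^a+1+2^b≤2^[a+b+2] (d₂ + κ * s) (d₃ + κ * 3 ^ d₃) ⟩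
    2 ^ exponent ∎
    where
    open ≤-Reasoning
    2^a*[2^κ]^b : ∀ g h → 2 ^ g * (2 ^ κ) ^ h ≡ 2 ^ (g + κ * h)
    2^a*[2^κ]^b g h = trans (cong (2 ^ g *_) (^-*-assoc 2 κ h)) (sym (^-distribˡ-+-* 2 g (κ * h)))

  exponent²≤3888*n*⌈log₂n⌉ : exponent * exponent ≤ 3888 * n * ⌈log₂ n ⌉
  exponent²≤3888*n*⌈log₂n⌉ = subst (λ l → exponent * exponent ≤ 3888 * n * l) (sym ⌈log₂n⌉≡1+t)
    (exponent²≤ {L} {d₂} {d₃} (s≤s z≤n) L≤n L*#cs≤n+L s*s≤4[1+#cs] 3^d₃≤3s)
    where
    L≤n : L ≤ n
    L≤n = subst (_≤ n) ⌈log₂n⌉≡1+t (⌈log₂n⌉≤n n)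
    L*#cs≤n+L : L * #cs ≤ n + L
    L*#cs≤n+L = subst (λ l → L * #cs ≤ l + L) length-allFin
                  (*-length-chunks≤ n (allFin n) (≤-reflexive length-allFin))

EqualityProtocol : (ℤ₆ → Bool) → ℕ → ℕ → Set
EqualityProtocol P c n =
  Σ[ k ∈ ℕ ] (BoundedBy c n k ×
    Σ[ A ∈ (Vec Bool n → Vector ℤ₆ k) ] Σ[ B ∈ (Vec Bool n → Vector ℤ₆ k) ]
      Σ[ C ∈ Poly₂ (k + k) ]
      (∀ (x y : Vec Bool n) → P (eval₂ C (A x ++ B y)) ≡ EQ x y))

equality-protocol : ∀ n → 2 ≤ n → EqualityProtocol isZero 3888 n
equality-protocol n 2≤n = with-⌈log₂n⌉ ⌈log₂ n ⌉ refl (⌈log₂⌉-mono-≤ 2≤n)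
  where
  with-⌈log₂n⌉ : ∀ l → ⌈log₂ n ⌉ ≡ l → 1 ≤ l → EqualityProtocol isZero 3888 n
  with-⌈log₂n⌉ (suc t) ⌈log₂n⌉≡1+t _ =
    #terms , (exponent , #terms≤2^exponent , exponent²≤3888*n*⌈log₂n⌉) ,
    left protocolₛ , right protocolₛ , innerProduct #terms , correct
    where
    open Construction n t ⌈log₂n⌉≡1+t
    open SeparableSums (Vec Bool n) (Vec Bool n) using (left; right)

propositionB27 : Σ[ P ∈ (ℤ₆ → Bool) ] Σ[ c ∈ ℕ ] Σ[ n₀ ∈ ℕ ] ∀ (n : ℕ) → n₀ ≤ n →
      Σ[ k ∈ ℕ ] (BoundedBy c n k ×
        Σ[ A ∈ (Vec Bool n → Vector ℤ₆ k) ] Σ[ B ∈ (Vec Bool n → Vector ℤ₆ k) ]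
          Σ[ C ∈ Poly₂ (k + k) ]
          (∀ (x y : Vec Bool n) →
            P (eval₂ C (A x ++ B y)) ≡ EQ x y))
propositionB27 = isZero , 3888 , 2 , equality-protocol
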